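{- Let $\sigma\in\Sigma$, $i\in\{1,\dots,n-1\}$, $I\subset\{\varphi_0,\dots,\varphi_{n-1}\}$ of cardinality $i$ and $\mathfrak R'=(\varphi_{j_1},\dots,\varphi_{j_n})$ a refinement compatible with $I$ (i.e. $I=\{\varphi_{j_1},\dots,\varphi_{j_i}\}$). The following are equivalent: (i) $s_i$ does not appear in some (equivalently any) reduced expression of $w_{\mathfrak R',\sigma}w_0$; (ii) $\mathrm{Fil}^{ -h_{i,\sigma}}(D_\sigma)\cap\big(\bigoplus_{\varphi_j\in I}Ee_j\big)=0$; (iii) the coefficient of $e_{I^c}$ in a nonzero vector of the line $\mathrm{Fil}^{\max}_iD_\sigma=\bigwedge_E^{n-i}\mathrm{Fil}^{ -h_{i,\sigma}}(D_\sigma)\subset\bigwedge^{n-i}_ED_\sigma$ is nonzero.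
   Context: $D_\sigma$ is an $n$-dimensional $E$-vector space ($n\ge2$) with an $E$-linear operator $\varphi^f$ having pairwise distinct eigenvalues $\varphi_0,\dots,\varphi_{n-1}$ (indeed $\varphi_j\varphi_k^{ -1}\notin\{1,p^f\}$ for $j\ne k$), a basis $e_0,\dots,e_{n-1}$ with $\varphi^f(e_j)=\varphi_je_j$, and a full flag $\mathrm{Fil}^{ -h_{j,\sigma}}(D_\sigma)$ ($h_{0,\sigma}>\dots>h_{n-1,\sigma}$, $\dim\mathrm{Fil}^{ -h_{j,\sigma}}(D_\sigma)=n-j$). For a subset $J$ of eigenvalues, $e_J=\wedge_{\varphi_j\in J}e_j$ (increasing $j$), $I^c$ the complement. For a refinement (ordering) $\mathfrak R=(\varphi_{j_1},\dots,\varphi_{j_n})$ put $e'_k=e_{j_k}$, choose $g\in\mathrm{GL}_n(E)$ whose first $k$ columns, in the basis $(e'_1,\dots,e'_n)$, span $\mathrm{Fil}^{ -h_{n-k,\sigma}}(D_\sigma)$ for each $k$, and let $w_{\mathfrak R,\sigma}\in S_n$ be the permutation with $g\in B(E)\dot wB(E)$ ($B$ upper triangular, $\dot w e_k=e_{w(k)}$ on the standard basis). $s_i=(i,i+1)$, $w_0$ the longest element of $S_n$. -}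

module Defs where

open import Level using (Level; _⊔_) renaming (suc to lsuc)
open import Algebra.Bundles using (CommutativeRing)
open import Data.Nat as ℕ using (ℕ; zero; suc; _<_; _≤_)
open import Data.Nat.Properties using (<-trans; ≤-refl; n<1+n)
open import Data.Fin as Fin using (Fin; toℕ; fromℕ<; punchIn; opposite)
open import Data.Fin.Permutation.Components using (transpose)
open import Data.Bool using (Bool; true; false; if_then_else_)
open import Data.List using (List; []; _∷_; foldr; length)
open import Data.List.Relation.Unary.All using (All)
open import Data.Product using (Σ; _×_; _,_; ∃)
open import Relation.Nullary using (¬_; yes; no; does)
open import Relation.Binary.PropositionalEquality using (_≡_)

record Field (c ℓ : Level) : Set (lsuc (c ⊔ ℓ)) where
  field
    commutativeRing : CommutativeRing c ℓ
  open CommutativeRing commutativeRing public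
  field
    1≉0     : ¬ (1# ≈ 0#)
    inverse : ∀ x → ¬ (x ≈ 0#) → Σ Carrier λ y → (x * y) ≈ 1#

-- Simple reflections and words in S_n (permutations of {0,…,n-1},
-- positions indexed 0-based; the paper's s_l = (l,l+1) on positions
-- 1..n is the swap of 0-based positions l-1 and l).

-- s l : the simple transposition s_l (identity if l ∉ {1,…,n-1};
-- words are always required to have valid letters anyway).
s : ∀ {n} → ℕ → Fin n → Fin n
s {n} zero    k = k
s {n} (suc m) k with suc m ℕ.<? n
... | yes sm<n = transpose (fromℕ< (<-trans (n<1+n m) sm<n)) (fromℕ< sm<n) k
... | no  _    = k

ValidLetter : ℕ → ℕ → Set
ValidLetter n l = (1 ≤ l) × (l < n)

-- product s_{l₁} s_{l₂} ⋯ s_{lₘ} of a word, as a map Fin n → Fin n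
-- (composition of maps, so the rightmost letter acts first)
wordPerm : ∀ {n} → List ℕ → Fin n → Fin n
wordPerm []       k = k
wordPerm (l ∷ ls) k = s l (wordPerm ls k)

IsExpression : ∀ n → List ℕ → (Fin n → Fin n) → Set
IsExpression n ls x = All (ValidLetter n) ls × (∀ k → wordPerm {n} ls k ≡ x k)

IsReducedExpression : ∀ n → List ℕ → (Fin n → Fin n) → Set
IsReducedExpression n ls x =
  IsExpression n ls x × (∀ ms → IsExpression n ms x → length ls ≤ length ms)

data Occurs (l : ℕ) : List ℕ → Set where
  here  : ∀ {ls} → Occurs l (l ∷ ls)
  there : ∀ {m ls} → Occurs l ls → Occurs l (m ∷ ls)

w₀ : ∀ {n} → Fin n → Fin n
w₀ = opposite

module LinAlg {c ℓ} (E : Field c ℓ) where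
  open Field E public

  Matrix : ℕ → ℕ → Set c
  Matrix m k = Fin m → Fin k → Carrier

  sumF : ∀ {n} → (Fin n → Carrier) → Carrier
  sumF {zero}  f = 0#
  sumF {suc n} f = f Fin.zero + sumF (λ a → f (Fin.suc a))

  altSumF : ∀ {n} → (Fin n → Carrier) → Carrier
  altSumF {zero}  f = 0#
  altSumF {suc n} f = f Fin.zero - altSumF (λ a → f (Fin.suc a))


  infixl 7 _·_
  _·_ : ∀ {m k l} → Matrix m k → Matrix k l → Matrix m l
  (A · B) a b = sumF (λ t → A a t * B t b)

  idM : ∀ {n} → Matrix n n
  idM a b = if does (a Fin.≟ b) then 1# else 0#

  infix 4 _≈M_
  _≈M_ : ∀ {m k} → Matrix m k → Matrix m k → Set ℓ
  A ≈M B = ∀ a b → A a b ≈ B a b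

  Invertible : ∀ {n} → Matrix n n → Set (c ⊔ ℓ)
  Invertible {n} A = Σ (Matrix n n) λ B → (A · B ≈M idM) × (B · A ≈M idM)

  UpperTriangular : ∀ {n} → Matrix n n → Set ℓ
  UpperTriangular A = ∀ a b → toℕ b < toℕ a → A a b ≈ 0#

  InBorel : ∀ {n} → Matrix n n → Set (c ⊔ ℓ)
  InBorel A = UpperTriangular A × Invertible A

  permMatrix : ∀ {n} → (Fin n → Fin n) → Matrix n n
  permMatrix w a b = if does (a Fin.≟ w b) then 1# else 0#

  InBruhatCell : ∀ {n} → Matrix n n → (Fin n → Fin n) → Set (c ⊔ ℓ)
  InBruhatCell {n} g w =
    Σ (Matrix n n) λ b₁ → Σ (Matrix n n) λ b₂ →
      InBorel b₁ × InBorel b₂ × (g ≈M (b₁ · permMatrix w · b₂))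

  det : ∀ {n} → Matrix n n → Carrier
  det {zero}  A = 1#
  det {suc n} A = altSumF (λ r → A r Fin.zero * det (λ a b → A (punchIn r a) (Fin.suc b)))

  fromℕ : ℕ → Carrier
  fromℕ zero    = 0#
  fromℕ (suc m) = 1# + fromℕ m

module Submission where

open import Defs
open import Data.Nat using (ℕ; _≤_; _<_; _∸_; _^_)
open import Data.Nat.Properties using (m∸n≤m)
open import Data.Nat.Primality using (Prime)
open import Data.Fin using (Fin; toℕ; inject≤)
open import Data.Fin.Subset using (Subset; _∈_; _∉_; ∣_∣)
open import Data.Fin.Permutation using (Permutation′; _⟨$⟩ʳ_)
open import Data.List using (List)
open import Data.Product using (Σ; _×_; ∃)
open import Function.Bundles using (_⇔_)
open import Relation.Nullary using (¬_)
open import Relation.Binary.PropositionalEquality using (_≡_; _≢_)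

open import Level using (_⊔_)
import Data.Nat.Properties as ℕ
open import Data.Fin using (opposite)
open import Data.Fin.Permutation using (_⟨$⟩ˡ_; inverseˡ; inverseʳ)
open import Data.Product using (_,_)
open import Function using (_∘_)
open import Function.Bundles using (Equivalence)
open import Function.Definitions using (Injective)
open import Function.Properties.Equivalence using () renaming (trans to ⇔-trans; sym to ⇔-sym)
open import Function.Related.Propositional using (module EquationalReasoning)
import Relation.Binary.PropositionalEquality as ≡

-- After relabelling the basis along the refinement, the flag is spanned by the columns of g = b₁ ẇ b₂
-- with b₁, b₂ upper triangular.  As b₁ and b₂ preserve the standard flag, (ii) holds iff w sends
-- {0, …, n-i-1} into {i, …, n-1}, i.e. iff w w₀ preserves the blocks {0, …, i-1} and {i, …, n-1}.
-- Bubble sort gives reduced words whose length is the number of inversions, and counting the inversions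
-- within and across the blocks shows that a word containing s_i of a block-preserving permutation has
-- at least two letters more; so w w₀ preserves the blocks iff some, equivalently every, reduced
-- expression avoids s_i.  Finally (ii) says that the minor of (iii) has trivial kernel, which is
-- equivalent to its determinant being nonzero: Cramer's rule one way, Gaussian elimination the other.

module Permutations where

  open import Data.Nat as ℕ using (ℕ; zero; suc; z≤n; s≤s; _+_; _≤_; _<_; _∸_)
  import Data.Nat.Properties as ℕ
  open import Data.Fin as Fin using (Fin; zero; suc; toℕ; fromℕ<; punchIn; punchOut; inject≤; opposite)
  open import Data.Fin.Properties
    using (toℕ-injective; toℕ-fromℕ<; toℕ<n; toℕ-inject≤; any?; pigeonhole; punchOut-injective; punchInᵢ≢i;
           opposite-prop; opposite-involutive)
  open import Data.Fin.Permutation.Components using (transpose)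
  open import Data.Vec.Functional using (removeAt)
  open import Algebra.Properties.CommutativeMonoid.Sum ℕ.+-0-commutativeMonoid
    using (sum; sum-remove; sum-cong-≗; sum-replicate-zero)
  open import Algebra.Properties.CommutativeSemigroup ℕ.+-commutativeSemigroup using (xy∙z≈zy∙x; xy∙z≈xz∙y)
  open import Data.List using ([]; _∷_; length)
  open import Data.List.Relation.Unary.All using (All; []; _∷_)
  open import Data.Product using (_×_; _,_; proj₁; proj₂; ∃; ∃₂)
  open import Data.Sum using (_⊎_; inj₁; inj₂)
  open import Data.Empty using (⊥; ⊥-elim)
  open import Function using (_∘_)
  open import Function.Bundles using (_⇔_; mk⇔; Equivalence)
  open import Function.Definitions using (Injective)
  open import Function.Properties.Equivalence using () renaming (trans to ⇔-trans; sym to ⇔-sym)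
  open import Relation.Nullary using (¬_; yes; no; Dec)
  open import Relation.Nullary.Decidable using (_×-dec_; ¬?; dec-true; dec-false)
  open import Relation.Binary.PropositionalEquality
    using (_≡_; _≢_; refl; sym; trans; cong; cong₂; subst; subst₂; module ≡-Reasoning)
  open import Relation.Binary.Definitions using (Tri; tri<; tri≈; tri>)

  injective⇒surjective : ∀ {n} {f : Fin n → Fin n} → Injective _≡_ _≡_ f → ∀ y → ∃ λ x → f x ≡ y
  injective⇒surjective {suc n} {f} f-inj y with any? (λ x → f x Fin.≟ y)
  ... | yes found = found
  ... | no  ∄x    = ⊥-elim (no-collision (pigeonhole (ℕ.n<1+n n) (λ x → punchOut (y≢f x))))
    where
    y≢f : ∀ x → y ≢ f x
    y≢f x y≡fx = ∄x (x , sym y≡fx)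
    no-collision : ¬ ∃₂ λ a b → a Fin.< b × punchOut (y≢f a) ≡ punchOut (y≢f b)
    no-collision (a , b , a<b , eq) = ℕ.<-irrefl (cong toℕ (f-inj (punchOut-injective (y≢f a) (y≢f b) eq))) a<b

  module Positions {n} {y : Fin n → Fin n} (y-inj : Injective _≡_ _≡_ y) where

    position : Fin n → Fin n
    position v = proj₁ (injective⇒surjective y-inj v)

    y∘position : ∀ v → y (position v) ≡ v
    y∘position v = proj₂ (injective⇒surjective y-inj v)

    position-injective : Injective _≡_ _≡_ position
    position-injective {a} {b} eq = trans (sym (y∘position a)) (trans (cong y eq) (y∘position b))

  consecutive-increasing⇒≡id : ∀ {n} (f : Fin n → Fin n) →
    (∀ a b → toℕ b ≡ suc (toℕ a) → toℕ (f a) < toℕ (f b)) → ∀ a → f a ≡ a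
  consecutive-increasing⇒≡id {n} f increasing a =
    toℕ-injective (ℕ.≤-antisym (above (n ∸ suc (toℕ a)) a (ℕ.m+[n∸m]≡n (toℕ<n a))) (below (toℕ a) a refl))
    where
    below : ∀ k a → toℕ a ≡ k → k ≤ toℕ (f a)
    below zero    a _     = z≤n
    below (suc k) a a≡1+k =
      ℕ.≤-<-trans (below k p (toℕ-fromℕ< k<n)) (increasing p a (trans a≡1+k (cong suc (sym (toℕ-fromℕ< k<n)))))
      where
      k<n : k < n
      k<n = ℕ.<-trans (ℕ.n<1+n k) (subst (_< n) a≡1+k (toℕ<n a))
      p = fromℕ< k<n
    above : ∀ d a → suc (toℕ a) + d ≡ n → toℕ (f a) ≤ toℕ a
    above zero    a a+1≡n =
      ℕ.≤-pred (subst (toℕ (f a) <_) (trans (sym a+1≡n) (ℕ.+-identityʳ _)) (toℕ<n (f a)))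
    above (suc d) a eq    = ℕ.≤-pred (ℕ.<-≤-trans (increasing a b (toℕ-fromℕ< 1+a<n))
                                                 (subst (toℕ (f b) ≤_) (toℕ-fromℕ< 1+a<n) (above d b eq′)))
      where
      1+a<n : suc (toℕ a) < n
      1+a<n = subst (suc (toℕ a) <_) eq (ℕ.m<m+n (suc (toℕ a)) (s≤s z≤n))
      b = fromℕ< 1+a<n
      eq′ : suc (toℕ b) + d ≡ n
      eq′ = trans (cong (λ t → suc t + d) (toℕ-fromℕ< 1+a<n)) (trans (sym (ℕ.+-suc (suc (toℕ a)) d)) eq)

  transpose-u : ∀ {n} (u v : Fin n) → transpose u v u ≡ v
  transpose-u u v rewrite dec-true (u Fin.≟ u) refl = refl

  transpose-v : ∀ {n} {u v : Fin n} → u ≢ v → transpose u v v ≡ u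
  transpose-v {u = u} {v} u≢v rewrite dec-false (v Fin.≟ u) (u≢v ∘ sym) | dec-true (v Fin.≟ v) refl = refl

  transpose-other : ∀ {n} {u v k : Fin n} → k ≢ u → k ≢ v → transpose u v k ≡ k
  transpose-other {u = u} {v} {k} k≢u k≢v rewrite dec-false (k Fin.≟ u) k≢u | dec-false (k Fin.≟ v) k≢v = refl

  s-adjacent : ∀ {n} {u v : Fin n} → toℕ v ≡ suc (toℕ u) → ∀ k → s (toℕ v) k ≡ transpose u v k
  s-adjacent {n} {u} {v} v≡1+u k rewrite v≡1+u with suc (toℕ u) ℕ.<? n
  ... | yes 1+u<n = cong₂ (λ a b → transpose a b k) (toℕ-injective (toℕ-fromℕ< _))
                          (toℕ-injective (trans (toℕ-fromℕ< 1+u<n) (sym v≡1+u)))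
  ... | no  1+u≮n = ⊥-elim (1+u≮n (subst (_< n) v≡1+u (toℕ<n v)))

  module AdjacentTransposition {n} {u v : Fin n} (v≡1+u : toℕ v ≡ suc (toℕ u)) where

    σ : Fin n → Fin n
    σ = transpose u v

    u<v : toℕ u < toℕ v
    u<v = subst (toℕ u <_) (sym v≡1+u) (ℕ.n<1+n _)

    u≢v : u ≢ v
    u≢v u≡v = ℕ.<-irrefl (cong toℕ u≡v) u<v

    data Transposed : Fin n → Fin n → Set where
      at-u  : Transposed u v
      at-v  : Transposed v u
      other : ∀ {k} → k ≢ u → k ≢ v → Transposed k k

    transposed : ∀ k → Transposed k (σ k)
    transposed k = view (k Fin.≟ u) (k Fin.≟ v)
      where
      view : Dec (k ≡ u) → Dec (k ≡ v) → Transposed k (σ k)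
      view (yes k≡u) _         =
        subst (λ k → Transposed k (σ k)) (sym k≡u) (subst (Transposed u) (sym (transpose-u u v)) at-u)
      view (no  _)   (yes k≡v) =
        subst (λ k → Transposed k (σ k)) (sym k≡v) (subst (Transposed v) (sym (transpose-v u≢v)) at-v)
      view (no  k≢u) (no  k≢v) = subst (Transposed k) (sym (transpose-other k≢u k≢v)) (other k≢u k≢v)

    σ-involutive : ∀ k → σ (σ k) ≡ k
    σ-involutive k with σ k | transposed k
    ... | _ | at-u          = transpose-v u≢v
    ... | _ | at-v          = transpose-u u v
    ... | _ | other k≢u k≢v = transpose-other k≢u k≢v

    σ-injective : Injective _≡_ _≡_ σ
    σ-injective {a} {b} σa≡σb = trans (sym (σ-involutive a)) (trans (cong σ σa≡σb) (σ-involutive b))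

    σ-monotone : ∀ {p q} → ¬ (q ≡ u × p ≡ v) → toℕ q < toℕ p → toℕ (σ q) < toℕ (σ p)
    σ-monotone {p} {q} not-uv q<p with σ q | transposed q | σ p | transposed p
    ... | _ | at-u        | _ | at-u        = ⊥-elim (ℕ.<-irrefl refl q<p)
    ... | _ | at-u        | _ | at-v        = ⊥-elim (not-uv (refl , refl))
    ... | _ | at-u        | _ | other _ p≢v =
      ℕ.≤∧≢⇒< (subst (_≤ toℕ p) (sym v≡1+u) q<p) (p≢v ∘ toℕ-injective ∘ sym)
    ... | _ | at-v        | _ | at-u        = ⊥-elim (ℕ.<-asym q<p u<v)
    ... | _ | at-v        | _ | at-v        = ⊥-elim (ℕ.<-irrefl refl q<p)
    ... | _ | at-v        | _ | other _ _   = ℕ.<-trans u<v q<p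
    ... | _ | other _ _   | _ | at-u        = ℕ.<-trans q<p u<v
    ... | _ | other q≢u _ | _ | at-v        =
      ℕ.≤∧≢⇒< (ℕ.≤-pred (subst (toℕ q <_) v≡1+u q<p)) (q≢u ∘ toℕ-injective)
    ... | _ | other _ _   | _ | other _ _   = q<p

    σ-order : ∀ {p q} → ¬ (q ≡ u × p ≡ v) → ¬ (q ≡ v × p ≡ u) →
              toℕ q < toℕ p ⇔ toℕ (σ q) < toℕ (σ p)
    σ-order {p} {q} not-uv not-vu = mk⇔ (σ-monotone not-uv) λ σq<σp →
      subst₂ (λ a b → toℕ a < toℕ b) (σ-involutive q) (σ-involutive p) (σ-monotone not-σvu σq<σp)
      where
      not-σvu : ¬ (σ q ≡ u × σ p ≡ v)
      not-σvu (σq≡u , σp≡v) = not-vu ( trans (sym (σ-involutive q)) (trans (cong σ σq≡u) (transpose-u u v))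
                                     , trans (sym (σ-involutive p)) (trans (cong σ σp≡v) (transpose-v u≢v)))

    u<i⇔v<i : ∀ {i} → toℕ v ≢ i → toℕ u < i ⇔ toℕ v < i
    u<i⇔v<i {i} v≢i = mk⇔ (λ u<i → ℕ.≤∧≢⇒< (subst (_≤ i) (sym v≡1+u) u<i) v≢i) (ℕ.<-trans u<v)

    σ-below : ∀ {i} → toℕ v ≢ i → ∀ k → toℕ k < i ⇔ toℕ (σ k) < i
    σ-below v≢i k with σ k | transposed k
    ... | _ | at-u      = u<i⇔v<i v≢i
    ... | _ | at-v      = ⇔-sym (u<i⇔v<i v≢i)
    ... | _ | other _ _ = mk⇔ (λ k<i → k<i) (λ k<i → k<i)

  record AdjacentLetter (n l : ℕ) : Set where
    field
      u v   : Fin n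
      v≡1+u : toℕ v ≡ suc (toℕ u)
      v≡l   : toℕ v ≡ l

    s≗transpose : ∀ k → s l k ≡ transpose u v k
    s≗transpose k = subst (λ l → s l k ≡ transpose u v k) v≡l (s-adjacent v≡1+u k)

  validLetter⇒adjacent : ∀ {n l} → ValidLetter n l → AdjacentLetter n l
  validLetter⇒adjacent {n} {suc m} (_ , 1+m<n) = record
    { u     = fromℕ< m<n
    ; v     = fromℕ< 1+m<n
    ; v≡1+u = trans (toℕ-fromℕ< 1+m<n) (cong suc (sym (toℕ-fromℕ< m<n)))
    ; v≡l   = toℕ-fromℕ< 1+m<n
    }
    where
    m<n : m < n
    m<n = ℕ.<-trans (ℕ.n<1+n m) 1+m<n

  wordPerm-injective : ∀ {n} ls → All (ValidLetter n) ls → Injective _≡_ _≡_ (wordPerm {n} ls)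
  wordPerm-injective []       []         eq = eq
  wordPerm-injective (l ∷ ls) (l✓ ∷ ls✓) eq =
    wordPerm-injective ls ls✓ (σ-injective (trans (sym (s≗transpose _)) (trans eq (s≗transpose _))))
    where
    open AdjacentLetter (validLetter⇒adjacent l✓)
    open AdjacentTransposition v≡1+u

  PreservesBlocks : ∀ {n} → ℕ → (Fin n → Fin n) → Set
  PreservesBlocks i x = ∀ k → toℕ k < i ⇔ toℕ (x k) < i

  preservesBlocks-cong : ∀ {n i} {x y : Fin n → Fin n} → (∀ k → x k ≡ y k) →
                         PreservesBlocks i x → PreservesBlocks i y
  preservesBlocks-cong {i = i} x≗y x-blocks k = subst (λ z → toℕ k < i ⇔ toℕ z < i) (x≗y k) (x-blocks k)

  wordPerm-preservesBlocks : ∀ {n i} ls → All (ValidLetter n) ls → ¬ Occurs i ls →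
                             PreservesBlocks i (wordPerm {n} ls)
  wordPerm-preservesBlocks         []       []         _      k = mk⇔ (λ k<i → k<i) (λ k<i → k<i)
  wordPerm-preservesBlocks {i = i} (l ∷ ls) (l✓ ∷ ls✓) i∉l∷ls k =
    ⇔-trans (wordPerm-preservesBlocks ls ls✓ (i∉l∷ls ∘ there) k)
            (subst (λ z → toℕ (wordPerm ls k) < i ⇔ toℕ z < i) (sym (s≗transpose _)) (σ-below v≢i (wordPerm ls k)))
    where
    open AdjacentLetter (validLetter⇒adjacent l✓)
    open AdjacentTransposition v≡1+u
    v≢i : toℕ v ≢ i
    v≢i v≡i = i∉l∷ls (subst (λ j → Occurs j (l ∷ ls)) (trans (sym v≡l) v≡i) here)

  indicator : ∀ {p} {P : Set p} → Dec P → ℕ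
  indicator (yes _) = 1
  indicator (no  _) = 0

  indicator-cong : ∀ {p q} {P : Set p} {Q : Set q} (P? : Dec P) (Q? : Dec Q) → (P → Q) → (Q → P) →
                   indicator P? ≡ indicator Q?
  indicator-cong (yes _) (yes _) _   _   = refl
  indicator-cong (no  _) (no  _) _   _   = refl
  indicator-cong (yes p) (no ¬q) P→Q _   = ⊥-elim (¬q (P→Q p))
  indicator-cong (no ¬p) (yes q) _   Q→P = ⊥-elim (¬p (Q→P q))

  indicator-yes : ∀ {p} {P : Set p} (P? : Dec P) → P → indicator P? ≡ 1
  indicator-yes (yes _) _ = refl
  indicator-yes (no ¬p) p = ⊥-elim (¬p p)

  indicator-no : ∀ {p} {P : Set p} (P? : Dec P) → ¬ P → indicator P? ≡ 0
  indicator-no (yes p) ¬p = ⊥-elim (¬p p)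
  indicator-no (no  _) _  = refl

  sum-update : ∀ {n} (f g : Fin n → ℕ) a → (∀ b → b ≢ a → f b ≡ g b) → sum f + g a ≡ sum g + f a
  sum-update {suc n} f g a f≡g = begin
      sum f + g a                      ≡⟨ cong (_+ g a) (sum-remove {i = a} f) ⟩
      f a + sum (removeAt f a) + g a   ≡⟨ cong (λ t → f a + t + g a) removed-equal ⟩
      f a + sum (removeAt g a) + g a   ≡⟨ xy∙z≈zy∙x (f a) _ (g a) ⟩
      g a + sum (removeAt g a) + f a   ≡⟨ cong (_+ f a) (sum-remove {i = a} g) ⟨
      sum g + f a                      ∎
    where
    open ≡-Reasoning
    removed-equal : sum (removeAt f a) ≡ sum (removeAt g a)
    removed-equal = sum-cong-≗ λ b → f≡g (punchIn a b) (punchInᵢ≢i a b)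

  count : ∀ {n} {P : Fin n → Fin n → Set} → (∀ a b → Dec (P a b)) → ℕ
  count P? = sum λ a → sum λ b → indicator (P? a b)

  count-cong : ∀ {n} {P Q : Fin n → Fin n → Set} (P? : ∀ a b → Dec (P a b)) (Q? : ∀ a b → Dec (Q a b)) →
               (∀ a b → P a b ⇔ Q a b) → count P? ≡ count Q?
  count-cong P? Q? P⇔Q = sum-cong-≗ λ a → sum-cong-≗ λ b →
    indicator-cong (P? a b) (Q? a b) (Equivalence.to (P⇔Q a b)) (Equivalence.from (P⇔Q a b))

  count-zero : ∀ {n} {P : Fin n → Fin n → Set} (P? : ∀ a b → Dec (P a b)) → (∀ a b → ¬ P a b) → count P? ≡ 0
  count-zero {n} P? ¬P = trans (sum-cong-≗ λ a → trans (sum-cong-≗ λ b → indicator-no (P? a b) (¬P a b))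
                                                       (sum-replicate-zero n))
                               (sum-replicate-zero n)

  count-update : ∀ {n} {P Q : Fin n → Fin n → Set} (P? : ∀ a b → Dec (P a b)) (Q? : ∀ a b → Dec (Q a b)) a₀ b₀ →
    (∀ a b → ¬ (a ≡ a₀ × b ≡ b₀) → P a b ⇔ Q a b) →
    count P? + indicator (Q? a₀ b₀) ≡ count Q? + indicator (P? a₀ b₀)
  count-update P? Q? a₀ b₀ P⇔Q = ℕ.+-cancelʳ-≡ (G a₀) _ _ (begin
      sum F + q + G a₀     ≡⟨ xy∙z≈xz∙y (sum F) q (G a₀) ⟩
      sum F + G a₀ + q     ≡⟨ cong (_+ q) rows ⟩
      sum G + F a₀ + q     ≡⟨ ℕ.+-assoc (sum G) (F a₀) q ⟩
      sum G + (F a₀ + q)   ≡⟨ cong (sum G +_) row-a₀ ⟩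
      sum G + (G a₀ + p)   ≡⟨ ℕ.+-assoc (sum G) (G a₀) p ⟨
      sum G + G a₀ + p     ≡⟨ xy∙z≈xz∙y (sum G) (G a₀) p ⟩
      sum G + p + G a₀     ∎)
    where
    open ≡-Reasoning
    F = λ a → sum λ b → indicator (P? a b)
    G = λ a → sum λ b → indicator (Q? a b)
    p = indicator (P? a₀ b₀)
    q = indicator (Q? a₀ b₀)
    same : ∀ a b → ¬ (a ≡ a₀ × b ≡ b₀) → indicator (P? a b) ≡ indicator (Q? a b)
    same a b not-a₀b₀ = indicator-cong (P? a b) (Q? a b) (Equivalence.to (P⇔Q a b not-a₀b₀))
                                                         (Equivalence.from (P⇔Q a b not-a₀b₀))
    rows : sum F + G a₀ ≡ sum G + F a₀
    rows = sum-update F G a₀ λ a a≢a₀ → sum-cong-≗ λ b → same a b (a≢a₀ ∘ proj₁)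
    row-a₀ : F a₀ + q ≡ G a₀ + p
    row-a₀ = sum-update (λ b → indicator (P? a₀ b)) (λ b → indicator (Q? a₀ b)) b₀ λ b b≢b₀ →
      same a₀ b (b≢b₀ ∘ proj₂)

  Inversion : ∀ {n} → (Fin n → Fin n) → Fin n → Fin n → Set
  Inversion y a b = toℕ a < toℕ b × toℕ (y b) < toℕ (y a)

  inversion? : ∀ {n} (y : Fin n → Fin n) a b → Dec (Inversion y a b)
  inversion? y a b = toℕ a ℕ.<? toℕ b ×-dec toℕ (y b) ℕ.<? toℕ (y a)

  inversions : ∀ {n} {C : Fin n → Fin n → Set} → (∀ a b → Dec (C a b)) → (Fin n → Fin n) → ℕ
  inversions C? y = count λ a b → C? a b ×-dec inversion? y a b

  inversions-cong : ∀ {n} {C : Fin n → Fin n → Set} (C? : ∀ a b → Dec (C a b)) {x y : Fin n → Fin n} →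
                    (∀ k → x k ≡ y k) → inversions C? x ≡ inversions C? y
  inversions-cong C? {x} {y} x≗y =
    count-cong (λ a b → C? a b ×-dec inversion? x a b) (λ a b → C? a b ×-dec inversion? y a b) λ a b →
      mk⇔ (λ (c , a<b , xb<xa) → c , a<b , subst₂ (λ s t → toℕ s < toℕ t) (x≗y b) (x≗y a) xb<xa)
          (λ (c , a<b , yb<ya) → c , a<b , subst₂ (λ s t → toℕ s < toℕ t) (sym (x≗y b)) (sym (x≗y a)) yb<ya)

  inversions-id : ∀ {n} {C : Fin n → Fin n → Set} (C? : ∀ a b → Dec (C a b)) → inversions C? (λ k → k) ≡ 0
  inversions-id C? = count-zero (λ a b → C? a b ×-dec inversion? (λ k → k) a b) λ a b (_ , a<b , b<a) → ℕ.<-asym a<b b<a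

  TakesValues : ∀ {n} → (Fin n → Fin n) → (a b u v : Fin n) → Set
  TakesValues y a b u v = (y a ≡ u × y b ≡ v) ⊎ (y a ≡ v × y b ≡ u)

  module AdjacentStep {n} {u v : Fin n} (v≡1+u : toℕ v ≡ suc (toℕ u))
                      {y : Fin n → Fin n} (y-inj : Injective _≡_ _≡_ y) {a₀ b₀ : Fin n} (a₀<b₀ : toℕ a₀ < toℕ b₀) (y-at : TakesValues y a₀ b₀ u v) where

    open AdjacentTransposition v≡1+u

    private
      at-a₀b₀ : ∀ {a b} → toℕ a < toℕ b → TakesValues y a b u v → a ≡ a₀ × b ≡ b₀
      at-a₀b₀ {a} {b} a<b y-ab = match y-ab y-at
        where
        match : TakesValues y a b u v → TakesValues y a₀ b₀ u v → a ≡ a₀ × b ≡ b₀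
        match (inj₁ (ya≡u , yb≡v)) (inj₁ (ya₀≡u , yb₀≡v)) =
          y-inj (trans ya≡u (sym ya₀≡u)) , y-inj (trans yb≡v (sym yb₀≡v))
        match (inj₂ (ya≡v , yb≡u)) (inj₂ (ya₀≡v , yb₀≡u)) =
          y-inj (trans ya≡v (sym ya₀≡v)) , y-inj (trans yb≡u (sym yb₀≡u))
        match (inj₁ (ya≡u , yb≡v)) (inj₂ (ya₀≡v , yb₀≡u)) = ⊥-elim (ℕ.<-asym a₀<b₀ (subst₂ (λ s t → toℕ s < toℕ t)
          (y-inj (trans ya≡u (sym yb₀≡u))) (y-inj (trans yb≡v (sym ya₀≡v))) a<b))
        match (inj₂ (ya≡v , yb≡u)) (inj₁ (ya₀≡u , yb₀≡v)) = ⊥-elim (ℕ.<-asym a₀<b₀ (subst₂ (λ s t → toℕ s < toℕ t)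
          (y-inj (trans ya≡v (sym yb₀≡v))) (y-inj (trans yb≡u (sym ya₀≡u))) a<b))

    inversion-elsewhere : ∀ a b → ¬ (a ≡ a₀ × b ≡ b₀) → Inversion y a b ⇔ Inversion (σ ∘ y) a b
    inversion-elsewhere a b not-a₀b₀ =
      mk⇔ (λ (a<b , yb<ya) → a<b , Equivalence.to (order a<b) yb<ya)
          (λ (a<b , σyb<σya) → a<b , Equivalence.from (order a<b) σyb<σya)
      where
      order : toℕ a < toℕ b → toℕ (y b) < toℕ (y a) ⇔ toℕ (σ (y b)) < toℕ (σ (y a))
      order a<b = σ-order (λ (yb≡u , ya≡v) → not-a₀b₀ (at-a₀b₀ a<b (inj₂ (ya≡v , yb≡u))))
                          (λ (yb≡v , ya≡u) → not-a₀b₀ (at-a₀b₀ a<b (inj₁ (ya≡u , yb≡v))))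

    inversion-removed : Inversion y a₀ b₀ → ¬ Inversion (σ ∘ y) a₀ b₀
    inversion-removed (_ , yb₀<ya₀) (_ , σyb₀<σya₀) = match y-at
      where
      match : TakesValues y a₀ b₀ u v → ⊥
      match (inj₁ (ya₀≡u , yb₀≡v)) =
        ℕ.<-asym u<v (subst₂ (λ s t → toℕ s < toℕ t) yb₀≡v ya₀≡u yb₀<ya₀)
      match (inj₂ (ya₀≡v , yb₀≡u)) = ℕ.<-asym u<v (subst₂ (λ s t → toℕ s < toℕ t)
        (trans (cong σ yb₀≡u) (transpose-u u v)) (trans (cong σ ya₀≡v) (transpose-v u≢v)) σyb₀<σya₀)

    inversion-created : ¬ Inversion y a₀ b₀ → Inversion (σ ∘ y) a₀ b₀
    inversion-created ¬inv = match y-at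
      where
      match : TakesValues y a₀ b₀ u v → Inversion (σ ∘ y) a₀ b₀
      match (inj₁ (ya₀≡u , yb₀≡v)) = a₀<b₀ , subst₂ (λ s t → toℕ s < toℕ t)
        (sym (trans (cong σ yb₀≡v) (transpose-v u≢v))) (sym (trans (cong σ ya₀≡u) (transpose-u u v))) u<v
      match (inj₂ (ya₀≡v , yb₀≡u)) =
        ⊥-elim (¬inv (a₀<b₀ , subst₂ (λ s t → toℕ s < toℕ t) (sym yb₀≡u) (sym ya₀≡v) u<v))

    module _ {C : Fin n → Fin n → Set} (C? : ∀ a b → Dec (C a b)) where

      private
        before after : ℕ
        before = indicator (C? a₀ b₀ ×-dec inversion? y a₀ b₀)
        after  = indicator (C? a₀ b₀ ×-dec inversion? (σ ∘ y) a₀ b₀)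

      inversions-σ : inversions C? (σ ∘ y) + before ≡ inversions C? y + after
      inversions-σ = count-update _ _ a₀ b₀ λ a b not-a₀b₀ →
        mk⇔ (λ (c , inv) → c , Equivalence.from (inversion-elsewhere a b not-a₀b₀) inv)
            (λ (c , inv) → c , Equivalence.to (inversion-elsewhere a b not-a₀b₀) inv)

      inversions-unchanged : ¬ C a₀ b₀ → inversions C? (σ ∘ y) ≡ inversions C? y
      inversions-unchanged ¬c = ℕ.+-cancelʳ-≡ 0 _ _
        (subst₂ (λ s t → inversions C? (σ ∘ y) + s ≡ inversions C? y + t)
        (indicator-no (C? a₀ b₀ ×-dec inversion? y a₀ b₀) (¬c ∘ proj₁))
        (indicator-no (C? a₀ b₀ ×-dec inversion? (σ ∘ y) a₀ b₀) (¬c ∘ proj₁)) inversions-σ)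

      inversions-decrease : C a₀ b₀ → Inversion y a₀ b₀ → suc (inversions C? (σ ∘ y)) ≡ inversions C? y
      inversions-decrease c inv = trans (ℕ.+-comm 1 _) (trans
        (subst₂ (λ s t → inversions C? (σ ∘ y) + s ≡ inversions C? y + t)
          (indicator-yes (C? a₀ b₀ ×-dec inversion? y a₀ b₀) (c , inv))
          (indicator-no (C? a₀ b₀ ×-dec inversion? (σ ∘ y) a₀ b₀) (inversion-removed inv ∘ proj₂)) inversions-σ)
        (ℕ.+-identityʳ _))

      inversions-increase : C a₀ b₀ → ¬ Inversion y a₀ b₀ → inversions C? (σ ∘ y) ≡ suc (inversions C? y)
      inversions-increase c ¬inv = trans (sym (ℕ.+-identityʳ _)) (trans
        (subst₂ (λ s t → inversions C? (σ ∘ y) + s ≡ inversions C? y + t)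
          (indicator-no (C? a₀ b₀ ×-dec inversion? y a₀ b₀) (¬inv ∘ proj₂))
          (indicator-yes (C? a₀ b₀ ×-dec inversion? (σ ∘ y) a₀ b₀) (c , inversion-created ¬inv)) inversions-σ)
        (ℕ.+-comm _ 1))

  occurs? : ∀ l ls → Dec (Occurs l ls)
  occurs? l []       = no λ ()
  occurs? l (m ∷ ls) with l ℕ.≟ m | occurs? l ls
  ... | yes refl | _        = yes here
  ... | no  _    | yes l∈ls = yes (there l∈ls)
  ... | no  l≢m  | no  l∉ls = no λ { here → l≢m refl ; (there l∈ls) → l∉ls l∈ls }

  occurs-head : ∀ {j l ls} → Occurs j (l ∷ ls) → ¬ Occurs j ls → j ≡ l
  occurs-head here         _    = refl
  occurs-head (there j∈ls) j∉ls = ⊥-elim (j∉ls j∈ls)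

  module Blocks (i : ℕ) where

    Crossing : ∀ {n} → Fin n → Fin n → Set
    Crossing a b = toℕ a < i × i ≤ toℕ b

    crossing? : ∀ {n} (a b : Fin n) → Dec (Crossing a b)
    crossing? a b = toℕ a ℕ.<? i ×-dec i ℕ.≤? toℕ b

    noncrossing? : ∀ {n} (a b : Fin n) → Dec (¬ Crossing a b)
    noncrossing? a b = ¬? (crossing? a b)

    W X : ∀ {n} → (Fin n → Fin n) → ℕ
    W = inversions noncrossing?
    X = inversions crossing?

    data Step (W X W′ X′ : ℕ) : Set where
      W-up   : W′ ≡ suc W → X′ ≡ X → Step W X W′ X′
      W-down : suc W′ ≡ W → X′ ≡ X → Step W X W′ X′
      X-up   : W′ ≡ W → X′ ≡ suc X → Step W X W′ X′
      X-down : W′ ≡ W → suc X′ ≡ X → Step W X W′ X′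

    step-total : ∀ {W X W′ X′} → Step W X W′ X′ → W′ + X′ ≤ suc (W + X)
    step-total             (W-up   refl refl) = ℕ.≤-refl
    step-total             (W-down refl refl) = ℕ.m≤n⇒m≤1+n (ℕ.n≤1+n _)
    step-total {W} {X}     (X-up   refl refl) = ℕ.≤-reflexive (ℕ.+-suc W X)
    step-total {W} {X′ = X′} (X-down refl refl) = ℕ.m≤n⇒m≤1+n (ℕ.+-monoʳ-≤ W (ℕ.n≤1+n X′))

    step-excess : ∀ {W X W′ X′ L} → Step W X W′ X′ → W + 2 ≤ L + X → W′ + 2 ≤ suc L + X′
    step-excess         (W-up   refl refl) h = s≤s h
    step-excess         (W-down refl refl) h = ℕ.≤-trans (ℕ.n≤1+n _) (ℕ.m≤n⇒m≤1+n h)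
    step-excess {L = L} (X-up   refl refl) h = ℕ.≤-trans h (ℕ.+-mono-≤ (ℕ.n≤1+n L) (ℕ.n≤1+n _))
    step-excess {L = L} (X-down refl refl) h = ℕ.≤-trans h (ℕ.≤-reflexive (ℕ.+-suc L _))

    module _ {n} {u v : Fin n} (v≡1+u : toℕ v ≡ suc (toℕ u)) {y : Fin n → Fin n} (y-inj : Injective _≡_ _≡_ y)
             {a₀ b₀ : Fin n} (a₀<b₀ : toℕ a₀ < toℕ b₀) (y-at : TakesValues y a₀ b₀ u v) where

      open AdjacentStep v≡1+u y-inj a₀<b₀ y-at
      open AdjacentTransposition v≡1+u using (σ)

      adjacent-step : Step (W y) (X y) (W (σ ∘ y)) (X (σ ∘ y))
      adjacent-step = cases (crossing? a₀ b₀) (inversion? y a₀ b₀)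
        where
        cases : Dec (Crossing a₀ b₀) → Dec (Inversion y a₀ b₀) → Step (W y) (X y) (W (σ ∘ y)) (X (σ ∘ y))
        cases (yes c)  (yes inv)  =
          X-down (inversions-unchanged noncrossing? λ ¬c → ¬c c) (inversions-decrease crossing? c inv)
        cases (yes c)  (no  ¬inv) =
          X-up (inversions-unchanged noncrossing? λ ¬c → ¬c c) (inversions-increase crossing? c ¬inv)
        cases (no  ¬c) (yes inv)  = W-down (inversions-decrease noncrossing? ¬c inv) (inversions-unchanged crossing? ¬c)
        cases (no  ¬c) (no  ¬inv) = W-up (inversions-increase noncrossing? ¬c ¬inv) (inversions-unchanged crossing? ¬c)

      adjacent-step-removes : Inversion y a₀ b₀ → suc (W (σ ∘ y) + X (σ ∘ y)) ≡ W y + X y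
      adjacent-step-removes inv with crossing? a₀ b₀
      ... | yes c  = trans (sym (ℕ.+-suc _ _)) (cong₂ _+_ (inversions-unchanged noncrossing? λ ¬c → ¬c c)
                                                           (inversions-decrease crossing? c inv))
      ... | no  ¬c = cong₂ _+_ (inversions-decrease noncrossing? ¬c inv) (inversions-unchanged crossing? ¬c)

      adjacent-step-crosses : Crossing a₀ b₀ → ¬ Inversion y a₀ b₀ →
                              W (σ ∘ y) ≡ W y × X (σ ∘ y) ≡ suc (X y)
      adjacent-step-crosses c ¬inv =
        inversions-unchanged noncrossing? (λ ¬c → ¬c c) , inversions-increase crossing? c ¬inv

    letter-step : ∀ {n l} → ValidLetter n l → ∀ {y : Fin n → Fin n} → Injective _≡_ _≡_ y →
                  Step (W y) (X y) (W (s l ∘ y)) (X (s l ∘ y))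
    letter-step {l = l} l✓ {y} y-inj =
      subst₂ (Step (W y) (X y)) (inversions-cong noncrossing? σy≗sy) (inversions-cong crossing? σy≗sy)
             (ordered (ℕ.<-cmp (toℕ (position u)) (toℕ (position v))))
      where
      open AdjacentLetter (validLetter⇒adjacent l✓)
      open AdjacentTransposition v≡1+u using (σ; u≢v)
      open Positions y-inj
      σy≗sy : ∀ k → σ (y k) ≡ s l (y k)
      σy≗sy k = sym (s≗transpose (y k))
      ordered : Tri (toℕ (position u) < toℕ (position v)) _ (toℕ (position v) < toℕ (position u)) →
                Step (W y) (X y) (W (σ ∘ y)) (X (σ ∘ y))
      ordered (tri< pu<pv _ _) = adjacent-step v≡1+u y-inj pu<pv (inj₁ (y∘position u , y∘position v))
      ordered (tri≈ _ pu≡pv _) = ⊥-elim (u≢v (position-injective (toℕ-injective pu≡pv)))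
      ordered (tri> _ _ pv<pu) = adjacent-step v≡1+u y-inj pv<pu (inj₂ (y∘position v , y∘position u))

    inversions-≤-length : ∀ {n} ls → All (ValidLetter n) ls → W (wordPerm {n} ls) + X (wordPerm {n} ls) ≤ length ls
    inversions-≤-length {n} []       []         =
      ℕ.≤-reflexive (cong₂ _+_ (inversions-id {n} noncrossing?) (inversions-id {n} crossing?))
    inversions-≤-length      (l ∷ ls) (l✓ ∷ ls✓) =
      ℕ.≤-trans (step-total (letter-step l✓ {wordPerm ls} (wordPerm-injective ls ls✓)))
                (s≤s (inversions-≤-length ls ls✓))

    preservesBlocks⇒X≡0 : ∀ {n} {y : Fin n → Fin n} → PreservesBlocks i y → X y ≡ 0
    preservesBlocks⇒X≡0 {y = y} y-blocks = count-zero (λ a b → crossing? a b ×-dec inversion? y a b)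
      λ a b ((a<i , i≤b) , _ , yb<ya) →
        ℕ.<⇒≱ (Equivalence.from (y-blocks b) (ℕ.<-trans yb<ya (Equivalence.to (y-blocks a) a<i))) i≤b

    -- The first occurrence of the letter i, applied to a block-preserving permutation, creates a crossing inversion.
    occurs⇒excess : ∀ {n} ls → All (ValidLetter n) ls → Occurs i ls →
                    W (wordPerm {n} ls) + 2 ≤ length ls + X (wordPerm {n} ls)
    occurs⇒excess (l ∷ ls) (l✓ ∷ ls✓) i∈l∷ls with occurs? i ls
    ... | yes i∈ls =
      step-excess (letter-step l✓ {wordPerm ls} (wordPerm-injective ls ls✓)) (occurs⇒excess ls ls✓ i∈ls)
    ... | no  i∉ls =
      subst₂ (λ w x → w + 2 ≤ suc (length ls) + x)
             (inversions-cong noncrossing? σy≗sy) (inversions-cong crossing? σy≗sy)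
        (begin
          W (σ ∘ y) + 2                  ≡⟨ cong (_+ 2) (proj₁ crosses) ⟩
          W y + 2                        ≤⟨ ℕ.+-monoˡ-≤ 2 W≤length ⟩
          length ls + 2                  ≡⟨ ℕ.+-suc (length ls) 1 ⟩
          suc (length ls) + 1            ≡⟨ cong (λ x → suc (length ls) + suc x) (preservesBlocks⇒X≡0 y-blocks) ⟨
          suc (length ls) + suc (X y)    ≡⟨ cong (suc (length ls) +_) (proj₂ crosses) ⟨
          suc (length ls) + X (σ ∘ y)    ∎)
      where
      open ℕ.≤-Reasoning
      open AdjacentLetter (validLetter⇒adjacent l✓)
      open AdjacentTransposition v≡1+u using (σ; u<v)
      y = wordPerm ls
      y-inj = wordPerm-injective ls ls✓
      open Positions y-inj
      y-blocks : PreservesBlocks i y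
      y-blocks = wordPerm-preservesBlocks ls ls✓ i∉ls
      v≡i : toℕ v ≡ i
      v≡i = trans v≡l (sym (occurs-head i∈l∷ls i∉ls))
      σy≗sy : ∀ k → σ (y k) ≡ s l (y k)
      σy≗sy k = sym (s≗transpose (y k))
      pu<i : toℕ (position u) < i
      pu<i = Equivalence.from (y-blocks (position u))
               (subst (λ k → toℕ k < i) (sym (y∘position u)) (subst (toℕ u <_) v≡i u<v))
      i≤pv : i ≤ toℕ (position v)
      i≤pv = ℕ.≮⇒≥ λ pv<i →
        ℕ.<-irrefl (trans (cong toℕ (y∘position v)) v≡i) (Equivalence.to (y-blocks (position v)) pv<i)
      no-inversion : ¬ Inversion y (position u) (position v)
      no-inversion (_ , yv<yu) = ℕ.<-asym u<v (subst₂ (λ s t → toℕ s < toℕ t) (y∘position v) (y∘position u) yv<yu)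
      W≤length : W y ≤ length ls
      W≤length = ℕ.≤-trans (ℕ.m≤m+n (W y) (X y)) (inversions-≤-length ls ls✓)
      crosses : W (σ ∘ y) ≡ W y × X (σ ∘ y) ≡ suc (X y)
      crosses = adjacent-step-crosses v≡1+u y-inj (ℕ.<-≤-trans pu<i i≤pv) (inj₁ (y∘position u , y∘position v))
                                      (pu<i , i≤pv) no-inversion

    -- Bubble sort: repeatedly swap a pair of consecutive values appearing in the wrong order.
    sortingWord : ∀ {n} k (y : Fin n → Fin n) → Injective _≡_ _≡_ y → W y + X y ≡ k →
                  ∃ λ ls → IsExpression n ls y × length ls ≡ k
    sortingWord {n} k y y-inj N≡k =
      sort k N≡k (any? λ u → any? λ v → toℕ v ℕ.≟ suc (toℕ u) ×-dec toℕ (position v) ℕ.<? toℕ (position u))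
      where
      open Positions y-inj
      Descent : Set
      Descent = ∃₂ λ u v → toℕ v ≡ suc (toℕ u) × toℕ (position v) < toℕ (position u)
      sort : ∀ k → W y + X y ≡ k → Dec Descent → ∃ λ ls → IsExpression n ls y × length ls ≡ k
      sort k N≡k (no ∄descent) = [] , ([] , λ t → sym (y≗id t)) , trans (sym N≡0) N≡k
        where
        position-increasing : ∀ u v → toℕ v ≡ suc (toℕ u) → toℕ (position u) < toℕ (position v)
        position-increasing u v v≡1+u =
          ℕ.≤∧≢⇒< (ℕ.≮⇒≥ λ pv<pu → ∄descent (u , v , v≡1+u , pv<pu)) λ pu≡pv →
            ℕ.<-irrefl (trans (cong toℕ (position-injective (toℕ-injective pu≡pv))) v≡1+u) (ℕ.n<1+n _)
        y≗id : ∀ t → y t ≡ t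
        y≗id t = trans (cong y (sym (consecutive-increasing⇒≡id position position-increasing t))) (y∘position t)
        N≡0 : W y + X y ≡ 0
        N≡0 = cong₂ _+_ (trans (inversions-cong noncrossing? y≗id) (inversions-id {n} noncrossing?))
                        (trans (inversions-cong crossing? y≗id) (inversions-id {n} crossing?))
      sort k N≡k (yes (u , v , v≡1+u , pv<pu)) = continue k N≡k
        where
        open AdjacentTransposition v≡1+u using (σ; σ-injective; σ-involutive; u<v)
        q = σ ∘ y
        N-decreases : suc (W q + X q) ≡ W y + X y
        N-decreases = adjacent-step-removes v≡1+u y-inj pv<pu (inj₂ (y∘position v , y∘position u))
          (pv<pu , subst₂ (λ s t → toℕ s < toℕ t) (sym (y∘position u)) (sym (y∘position v)) u<v)
        v✓ : ValidLetter n (toℕ v)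
        v✓ = subst (1 ≤_) (sym v≡1+u) (s≤s z≤n) , toℕ<n v
        continue : ∀ k → W y + X y ≡ k → ∃ λ ls → IsExpression n ls y × length ls ≡ k
        continue zero    N≡0   = ⊥-elim (ℕ.1+n≢0 (trans N-decreases N≡0))
        continue (suc k) N≡1+k with sortingWord k q (y-inj ∘ σ-injective) (ℕ.suc-injective (trans N-decreases N≡1+k))
        ... | ls , (ls✓ , ls≗q) , length≡k =
          toℕ v ∷ ls ,
          (v✓ ∷ ls✓ , λ t → trans (s-adjacent v≡1+u _) (trans (cong σ (ls≗q t)) (σ-involutive (y t)))) ,
          cong suc length≡k

    module _ {n} {x : Fin n → Fin n} (x-inj : Injective _≡_ _≡_ x) where

      private
        sorted : ∃ λ ls → IsExpression n ls x × length ls ≡ W x + X x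
        sorted = sortingWord (W x + X x) x x-inj refl
        ls₀ = proj₁ sorted
        ls₀-length = proj₂ (proj₂ sorted)

      inversions-≤-expression : ∀ {ms} → IsExpression n ms x → W x + X x ≤ length ms
      inversions-≤-expression {ms} (ms✓ , ms≗x) =
        subst (_≤ length ms) (cong₂ _+_ (inversions-cong noncrossing? ms≗x) (inversions-cong crossing? ms≗x))
              (inversions-≤-length ms ms✓)

      sortingWord-reduced : IsReducedExpression n ls₀ x
      sortingWord-reduced = proj₁ (proj₂ sorted) , λ ms ms-expr →
        subst (_≤ length ms) (sym ls₀-length) (inversions-≤-expression ms-expr)

      preservesBlocks⇒reduced-¬occurs : PreservesBlocks i x → ∀ ls → IsReducedExpression n ls x → ¬ Occurs i ls
      preservesBlocks⇒reduced-¬occurs x-blocks ls ((ls✓ , ls≗x) , minimal) i∈ls = ℕ.m+1+n≰m (W x) (begin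
          W x + 2             ≤⟨ subst₂ (λ w z → w + 2 ≤ length ls + z)
                                   (inversions-cong noncrossing? ls≗x) (inversions-cong crossing? ls≗x)
                                   (occurs⇒excess ls ls✓ i∈ls) ⟩
          length ls + X x     ≤⟨ ℕ.+-monoˡ-≤ (X x) (minimal ls₀ (proj₁ sortingWord-reduced)) ⟩
          length ls₀ + X x    ≡⟨ cong (_+ X x) ls₀-length ⟩
          W x + X x + X x     ≡⟨ cong (λ z → W x + z + z) (preservesBlocks⇒X≡0 x-blocks) ⟩
          W x + 0 + 0         ≡⟨ cong (_+ 0) (ℕ.+-identityʳ (W x)) ⟩
          W x + 0             ≡⟨ ℕ.+-identityʳ (W x) ⟩
          W x                 ∎)
        where open ℕ.≤-Reasoning

      someReduced⇔preservesBlocks : (∃ λ ls → IsReducedExpression n ls x × ¬ Occurs i ls) ⇔ PreservesBlocks i x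
      someReduced⇔preservesBlocks = mk⇔
        (λ (ls , ((ls✓ , ls≗x) , _) , i∉ls) → preservesBlocks-cong ls≗x (wordPerm-preservesBlocks ls ls✓ i∉ls))
        (λ x-blocks → ls₀ , sortingWord-reduced , preservesBlocks⇒reduced-¬occurs x-blocks ls₀ sortingWord-reduced)

      everyReduced⇔preservesBlocks : (∀ ls → IsReducedExpression n ls x → ¬ Occurs i ls) ⇔ PreservesBlocks i x
      everyReduced⇔preservesBlocks = mk⇔
        (λ every → preservesBlocks-cong (proj₂ (proj₁ sortingWord-reduced))
                     (wordPerm-preservesBlocks ls₀ (proj₁ (proj₁ sortingWord-reduced)) (every ls₀ sortingWord-reduced)))
        preservesBlocks⇒reduced-¬occurs

  opposite-injective : ∀ {n} → Injective _≡_ _≡_ (opposite {n})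
  opposite-injective {x = a} {b} oa≡ob =
    trans (sym (opposite-involutive a)) (trans (cong opposite oa≡ob) (opposite-involutive b))

  MapsPrefixAbove : ∀ {n} → (Fin n → Fin n) → ℕ → ℕ → Set
  MapsPrefixAbove w m i = ∀ j → toℕ j < m → i ≤ toℕ (w j)

  prefix-surjective : ∀ {n i} → i ≤ n → {f : Fin n → Fin n} → Injective _≡_ _≡_ f →
    (∀ k → toℕ k < i → toℕ (f k) < i) → ∀ k → toℕ k < i → ∃ λ t → toℕ t < i × f t ≡ k
  prefix-surjective {n} {i} i≤n {f} f-inj f-prefix k k<i =
    inject≤ t i≤n , inject≤-< t ,
    toℕ-injective (trans (sym (toℕ-fromℕ< _)) (trans (cong toℕ gt≡k) (toℕ-fromℕ< k<i)))
    where
    inject≤-< : ∀ t → toℕ (inject≤ t i≤n) < i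
    inject≤-< t = subst (_< i) (sym (toℕ-inject≤ t i≤n)) (toℕ<n t)
    g : Fin i → Fin i
    g t = fromℕ< (f-prefix (inject≤ t i≤n) (inject≤-< t))
    g-inj : Injective _≡_ _≡_ g
    g-inj {a} {b} ga≡gb =
      toℕ-injective (trans (sym (toℕ-inject≤ a i≤n)) (trans (cong toℕ (f-inj f-eq)) (toℕ-inject≤ b i≤n)))
      where
      f-eq : f (inject≤ a i≤n) ≡ f (inject≤ b i≤n)
      f-eq = toℕ-injective (trans (sym (toℕ-fromℕ< _)) (trans (cong toℕ ga≡gb) (toℕ-fromℕ< _)))
    t = proj₁ (injective⇒surjective g-inj (fromℕ< k<i))
    gt≡k = proj₂ (injective⇒surjective g-inj (fromℕ< k<i))

  -- Reversing positions turns "w sends [0, n - i) above i" into "w ∘ w₀ sends [i, n) into itself";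
  -- for a permutation, the latter forces it to preserve [0, i) as well.
  mapsPrefixAbove⇔preservesBlocks : ∀ {n i} → i ≤ n → {w : Fin n → Fin n} → Injective _≡_ _≡_ w →
    MapsPrefixAbove w (n ∸ i) i ⇔ PreservesBlocks i (w ∘ opposite)
  mapsPrefixAbove⇔preservesBlocks {n} {i} i≤n {w} w-inj = mk⇔ to from
    where
    x = w ∘ opposite
    open Positions {y = x} (opposite-injective ∘ w-inj)
    opposite-< : ∀ k → i ≤ toℕ k → toℕ (opposite k) < n ∸ i
    opposite-< k i≤k = subst (_< n ∸ i) (sym (opposite-prop k)) (ℕ.∸-monoʳ-< (s≤s i≤k) (toℕ<n k))
    i≤opposite : ∀ j → toℕ j < n ∸ i → i ≤ toℕ (opposite j)
    i≤opposite j j<n∸i = subst (i ≤_) (sym (opposite-prop j)) (ℕ.m+n≤o⇒m≤o∸n i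
      (subst (_≤ n) (ℕ.+-comm (suc (toℕ j)) i) (ℕ.m≤o∸n⇒m+n≤o (suc (toℕ j)) i≤n j<n∸i)))
    from : PreservesBlocks i x → MapsPrefixAbove w (n ∸ i) i
    from x-blocks j j<n∸i = subst (λ z → i ≤ toℕ (w z)) (opposite-involutive j) (ℕ.≮⇒≥ λ x[oj]<i →
      ℕ.<⇒≱ (Equivalence.from (x-blocks (opposite j)) x[oj]<i) (i≤opposite j j<n∸i))
    to : MapsPrefixAbove w (n ∸ i) i → PreservesBlocks i x
    to maps k = mk⇔ (forward k) (backward k)
      where
      backward : ∀ k → toℕ (x k) < i → toℕ k < i
      backward k xk<i = ℕ.≰⇒> λ i≤k → ℕ.<⇒≱ xk<i (maps (opposite k) (opposite-< k i≤k))
      forward : ∀ k → toℕ k < i → toℕ (x k) < i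
      forward k k<i with prefix-surjective i≤n position-injective
                           (λ t t<i → backward (position t) (subst (λ z → toℕ z < i) (sym (y∘position t)) t<i)) k k<i
      ... | t , t<i , pt≡k = subst (λ z → toℕ z < i) (trans (sym (y∘position t)) (cong x pt≡k)) t<i

module Matrices {c ℓ} (E : Field c ℓ) where

  open import Level using (_⊔_)
  open import Data.Nat as ℕ using (ℕ; zero; suc; z≤n; s≤s)
  import Data.Nat.Properties as ℕ
  open import Data.Fin as Fin using (Fin; zero; suc; toℕ; punchIn; punchOut; inject≤; fromℕ<; lift)
  open import Data.Fin.Properties using (suc-injective; punchIn-punchOut; toℕ-injective; toℕ-fromℕ<; toℕ<n; toℕ-inject≤)
  open import Data.Vec.Functional using (updateAt)
  open import Data.Vec.Functional.Properties using (updateAt-updates; updateAt-minimal; updateAt-commutes; updateAt-id-local)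
  open import Data.Bool using (if_then_else_)
  open import Data.Product using (_,_; proj₁; proj₂; ∃)
  open import Data.Empty using (⊥-elim)
  open import Function using (_∘_; const; case_of_)
  open import Data.Fin.Permutation using (Permutation′; _⟨$⟩ʳ_; _⟨$⟩ˡ_; inverseʳ)
  open import Function.Bundles using (_⇔_; mk⇔)
  open import Relation.Nullary using (¬_; yes; no; does; Dec)
  open import Relation.Nullary.Decidable using (dec-true; dec-false)
  open import Relation.Binary.PropositionalEquality as ≡ using (_≡_; _≢_; _≗_)
  open import Relation.Binary.Definitions using (tri<; tri≈; tri>)
  open import Data.Fin.Induction using (>-wellFounded)
  open import Induction.WellFounded using (module All)
  open Permutations using (MapsPrefixAbove)

  open LinAlg E hiding (zero)
  open import Algebra.Properties.Ring ring
    using (-0#≈0#; -‿involutive; -‿injective; -‿+-comm; -‿distribˡ-*; -‿distribʳ-*; +-inverseʳ-unique; x[y-z]≈xy-xz;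
           x∙y⁻¹≈ε⇒x≈y)
  open import Algebra.Properties.CommutativeSemigroup +-commutativeSemigroup using (interchange)
  open import Algebra.Properties.CommutativeSemigroup *-commutativeSemigroup using (x∙yz≈y∙xz)
  open import Relation.Binary.Reasoning.Setoid setoid

  ¬¬-∀-Fin : ∀ {n p} {P : Fin n → Set p} → (∀ r → ¬ ¬ P r) → ¬ ¬ (∀ r → P r)
  ¬¬-∀-Fin {zero}          ¬¬P ¬∀P = ¬∀P λ ()
  ¬¬-∀-Fin {suc n} {P = P} ¬¬P ¬∀P = ¬¬P zero λ P₀ →
    ¬¬-∀-Fin {P = P ∘ suc} (¬¬P ∘ suc) λ P₊ → ¬∀P λ { zero → P₀ ; (suc r) → P₊ r }

  x≉0∧x*y≈0⇒y≈0 : ∀ {x y} → x ≉ 0# → x * y ≈ 0# → y ≈ 0#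
  x≉0∧x*y≈0⇒y≈0 {x} {y} x≉0 xy≈0 with inverse x x≉0
  ... | x⁻¹ , xx⁻¹≈1 = begin
    y              ≈⟨ *-identityˡ y ⟨
    1# * y         ≈⟨ *-congʳ (trans (sym xx⁻¹≈1) (*-comm x x⁻¹)) ⟩
    x⁻¹ * x * y    ≈⟨ *-assoc x⁻¹ x y ⟩
    x⁻¹ * (x * y)  ≈⟨ *-congˡ xy≈0 ⟩
    x⁻¹ * 0#       ≈⟨ zeroʳ x⁻¹ ⟩
    0#             ∎

  -‿≈0⇒≈0 : ∀ {x} → - x ≈ 0# → x ≈ 0#
  -‿≈0⇒≈0 -x≈0 = -‿injective (trans -x≈0 (sym -0#≈0#))

  -- Finite sums

  sumF-cong : ∀ {n} {f g : Fin n → Carrier} → (∀ a → f a ≈ g a) → sumF f ≈ sumF g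
  sumF-cong {zero}  f≈g = refl
  sumF-cong {suc n} f≈g = +-cong (f≈g zero) (sumF-cong (f≈g ∘ suc))

  sumF-zero : ∀ {n} {f : Fin n → Carrier} → (∀ a → f a ≈ 0#) → sumF f ≈ 0#
  sumF-zero {zero}  f≈0 = refl
  sumF-zero {suc n} f≈0 = trans (+-cong (f≈0 zero) (sumF-zero (f≈0 ∘ suc))) (+-identityˡ 0#)

  sumF-+ : ∀ {n} (f g : Fin n → Carrier) → sumF (λ a → f a + g a) ≈ sumF f + sumF g
  sumF-+ {zero}  f g = sym (+-identityˡ 0#)
  sumF-+ {suc n} f g = trans (+-congˡ (sumF-+ (f ∘ suc) (g ∘ suc))) (interchange _ _ _ _)

  *-distribˡ-sumF : ∀ {n} x (f : Fin n → Carrier) → x * sumF f ≈ sumF (λ a → x * f a)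
  *-distribˡ-sumF {zero}  x f = zeroʳ x
  *-distribˡ-sumF {suc n} x f = trans (distribˡ x _ _) (+-congˡ (*-distribˡ-sumF x (f ∘ suc)))

  *-distribʳ-sumF : ∀ {n} x (f : Fin n → Carrier) → sumF f * x ≈ sumF (λ a → f a * x)
  *-distribʳ-sumF {zero}  x f = zeroˡ x
  *-distribʳ-sumF {suc n} x f = trans (distribʳ x _ _) (+-congˡ (*-distribʳ-sumF x (f ∘ suc)))

  sumF-neg : ∀ {n} (f : Fin n → Carrier) → sumF (λ a → - f a) ≈ - sumF f
  sumF-neg {zero}  f = sym -0#≈0#
  sumF-neg {suc n} f = trans (+-congˡ (sumF-neg (f ∘ suc))) (-‿+-comm _ _)

  sumF-comm : ∀ {m n} (f : Fin m → Fin n → Carrier) →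
              sumF (λ a → sumF (f a)) ≈ sumF (λ b → sumF (λ a → f a b))
  sumF-comm {zero} {n} f = sym (sumF-zero {n} λ _ → refl)
  sumF-comm {suc m} f = trans (+-congˡ (sumF-comm (f ∘ suc))) (sym (sumF-+ (f zero) _))

  sumF-single : ∀ {n} (f : Fin n → Carrier) k → (∀ a → a ≢ k → f a ≈ 0#) → sumF f ≈ f k
  sumF-single {suc n} f zero    f≈0 =
    trans (+-congˡ (sumF-zero λ a → f≈0 (suc a) λ ())) (+-identityʳ _)
  sumF-single {suc n} f (suc k) f≈0 =
    trans (+-cong (f≈0 zero λ ()) (sumF-single (f ∘ suc) k λ a a≢k → f≈0 (suc a) (a≢k ∘ suc-injective)))
          (+-identityˡ _)

  sumF-inject≤ : ∀ {m n} (m≤n : m ℕ.≤ n) (f : Fin n → Carrier) → (∀ t → m ℕ.≤ toℕ t → f t ≈ 0#) →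
                 sumF f ≈ sumF (λ b → f (inject≤ b m≤n))
  sumF-inject≤ z≤n       f f≈0 = sumF-zero λ t → f≈0 t z≤n
  sumF-inject≤ (s≤s m≤n) f f≈0 = +-congˡ (sumF-inject≤ m≤n (f ∘ suc) λ t m≤t → f≈0 (suc t) (s≤s m≤t))

  altSumF-cong : ∀ {n} {f g : Fin n → Carrier} → (∀ a → f a ≈ g a) → altSumF f ≈ altSumF g
  altSumF-cong {zero}  f≈g = refl
  altSumF-cong {suc n} f≈g = +-cong (f≈g zero) (-‿cong (altSumF-cong (f≈g ∘ suc)))

  altSumF-zero : ∀ {n} {f : Fin n → Carrier} → (∀ a → f a ≈ 0#) → altSumF f ≈ 0#
  altSumF-zero {zero}  f≈0 = refl
  altSumF-zero {suc n} f≈0 =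
    trans (+-cong (f≈0 zero) (trans (-‿cong (altSumF-zero (f≈0 ∘ suc))) -0#≈0#)) (+-identityˡ 0#)

  altSumF-+ : ∀ {n} (f g : Fin n → Carrier) → altSumF (λ a → f a + g a) ≈ altSumF f + altSumF g
  altSumF-+ {zero}  f g = sym (+-identityˡ 0#)
  altSumF-+ {suc n} f g =
    trans (+-congˡ (trans (-‿cong (altSumF-+ (f ∘ suc) (g ∘ suc))) (sym (-‿+-comm _ _)))) (interchange _ _ _ _)

  altSumF-neg : ∀ {n} (f : Fin n → Carrier) → altSumF (λ a → - f a) ≈ - altSumF f
  altSumF-neg {zero}  f = sym -0#≈0#
  altSumF-neg {suc n} f = trans (+-congˡ (-‿cong (altSumF-neg (f ∘ suc)))) (-‿+-comm _ _)

  altSumF-sub : ∀ {n} (f g : Fin n → Carrier) → altSumF (λ a → f a - g a) ≈ altSumF f - altSumF g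
  altSumF-sub f g = trans (altSumF-+ f (λ a → - g a)) (+-congˡ (altSumF-neg g))

  *-distribˡ-altSumF : ∀ {n} x (f : Fin n → Carrier) → x * altSumF f ≈ altSumF (λ a → x * f a)
  *-distribˡ-altSumF {zero}  x f = zeroʳ x
  *-distribˡ-altSumF {suc n} x f =
    trans (distribˡ x _ _) (+-congˡ (trans (sym (-‿distribʳ-* x _)) (-‿cong (*-distribˡ-altSumF x (f ∘ suc)))))

  altSumF-isolate : ∀ {n} (f : Fin n → Carrier) k → (∀ a → a ≢ k → f a ≈ 0#) → altSumF f ≈ 0# → f k ≈ 0#
  altSumF-isolate {suc n} f zero    f≈0 Σ≈0 = begin
    f zero                        ≈⟨ +-identityʳ _ ⟨
    f zero + 0#                   ≈⟨ +-congˡ (trans (sym -0#≈0#) (-‿cong (sym rest≈0))) ⟩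
    f zero - altSumF (f ∘ suc)    ≈⟨ Σ≈0 ⟩
    0#                            ∎
    where
    rest≈0 : altSumF (f ∘ suc) ≈ 0#
    rest≈0 = altSumF-zero λ a → f≈0 (suc a) λ ()
  altSumF-isolate {suc n} f (suc k) f≈0 Σ≈0 =
    altSumF-isolate (f ∘ suc) k (λ a a≢k → f≈0 (suc a) (a≢k ∘ suc-injective))
      (-‿≈0⇒≈0 (trans (sym (trans (+-congʳ (f≈0 zero λ ())) (+-identityˡ _))) Σ≈0))

  -- Determinants

  minor : ∀ {n} → Fin (suc n) → Matrix (suc n) (suc n) → Matrix n n
  minor r A a b = A (punchIn r a) (suc b)

  det-cong : ∀ {n} {A B : Matrix n n} → A ≈M B → det A ≈ det B
  det-cong {zero}  A≈B = refl
  det-cong {suc n} A≈B = altSumF-cong λ r → *-cong (A≈B r zero) (det-cong λ a b → A≈B (punchIn r a) (suc b))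

  -- Defined through updateAt, so that the minors of a matrix with a replaced column are,
  -- definitionally, the minors of the original matrix with a replaced column.
  replaceColumn : ∀ {n} → Matrix n n → Fin n → (Fin n → Carrier) → Matrix n n
  replaceColumn A j v r = updateAt (A r) j (const (v r))

  replaceColumn-same : ∀ {n} (A : Matrix n n) j v r → replaceColumn A j v r j ≡ v r
  replaceColumn-same A j v r = updateAt-updates j (A r)

  replaceColumn-other : ∀ {n} (A : Matrix n n) {j c} v r → c ≢ j → replaceColumn A j v r c ≡ A r c
  replaceColumn-other A {j} {c} v r c≢j = updateAt-minimal c j (A r) c≢j

  replaceColumn-self : ∀ {n} (A : Matrix n n) j → replaceColumn A j (λ r → A r j) ≈M A
  replaceColumn-self A j r c = reflexive (updateAt-id-local j (A r) ≡.refl c)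

  det-replaceColumn-zero : ∀ {n} (A : Matrix n n) j {v} → (∀ r → v r ≈ 0#) → det (replaceColumn A j v) ≈ 0#
  det-replaceColumn-zero {suc n} A zero    v≈0 = altSumF-zero λ r → trans (*-congʳ (v≈0 r)) (zeroˡ (det (minor r A)))
  det-replaceColumn-zero {suc n} A (suc j) v≈0 =
    altSumF-zero λ r → trans (*-congˡ (det-replaceColumn-zero (minor r A) j (v≈0 ∘ punchIn r))) (zeroʳ (A r zero))

  det-replaceColumn-+ : ∀ {n} (A : Matrix n n) j (u v : Fin n → Carrier) →
    det (replaceColumn A j (λ r → u r + v r)) ≈ det (replaceColumn A j u) + det (replaceColumn A j v)
  det-replaceColumn-+ {suc n} A zero    u v =
    trans (altSumF-cong λ r → distribʳ (det (minor r A)) (u r) (v r))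
          (altSumF-+ (λ r → u r * det (minor r A)) (λ r → v r * det (minor r A)))
  det-replaceColumn-+ {suc n} A (suc j) u v =
    trans (altSumF-cong λ r → trans (*-congˡ (det-replaceColumn-+ (minor r A) j (u ∘ punchIn r) (v ∘ punchIn r)))
                                    (distribˡ (A r zero) (det (replaceColumn (minor r A) j (u ∘ punchIn r)))
                                                                (det (replaceColumn (minor r A) j (v ∘ punchIn r)))))
          (altSumF-+ (λ r → A r zero * det (replaceColumn (minor r A) j (u ∘ punchIn r)))
                     (λ r → A r zero * det (replaceColumn (minor r A) j (v ∘ punchIn r))))

  det-replaceColumn-* : ∀ {n} (A : Matrix n n) j x (v : Fin n → Carrier) →
    det (replaceColumn A j (λ r → x * v r)) ≈ x * det (replaceColumn A j v)
  det-replaceColumn-* {suc n} A zero    x v =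
    trans (altSumF-cong λ r → *-assoc x (v r) (det (minor r A))) (sym (*-distribˡ-altSumF x λ r → v r * det (minor r A)))
  det-replaceColumn-* {suc n} A (suc j) x v =
    trans (altSumF-cong λ r → trans (*-congˡ (det-replaceColumn-* (minor r A) j x (v ∘ punchIn r)))
                                    (x∙yz≈y∙xz (A r zero) x (det (replaceColumn (minor r A) j (v ∘ punchIn r)))))
          (sym (*-distribˡ-altSumF x λ r → A r zero * det (replaceColumn (minor r A) j (v ∘ punchIn r))))

  det-replaceColumn-sumF : ∀ {n k} (A : Matrix n n) j (x : Fin k → Carrier) (u : Fin k → Fin n → Carrier) →
    det (replaceColumn A j (λ r → sumF (λ b → x b * u b r))) ≈ sumF (λ b → x b * det (replaceColumn A j (u b)))
  det-replaceColumn-sumF {k = zero}  A j x u = det-replaceColumn-zero A j λ r → refl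
  det-replaceColumn-sumF {k = suc k} A j x u =
    trans (det-replaceColumn-+ A j _ _)
          (+-cong (det-replaceColumn-* A j _ _) (det-replaceColumn-sumF A j (x ∘ suc) (u ∘ suc)))

  replaceColumns : ∀ {n} → Matrix n n → Fin n → Fin n → (x y : Fin n → Carrier) → Matrix n n
  replaceColumns A j k x y = replaceColumn (replaceColumn A j x) k y

  replaceColumns-j : ∀ {n} (A : Matrix n n) {j k} x y r → j ≢ k → replaceColumns A j k x y r j ≡ x r
  replaceColumns-j A {j} x y r j≢k = ≡.trans (replaceColumn-other (replaceColumn A j x) y r j≢k) (replaceColumn-same A j x r)

  replaceColumns-k : ∀ {n} (A : Matrix n n) {j k} x y r → replaceColumns A j k x y r k ≡ y r
  replaceColumns-k A {j} {k} x y r = replaceColumn-same (replaceColumn A j x) k y r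

  replaceColumns-other : ∀ {n} (A : Matrix n n) {j k c} x y r → c ≢ j → c ≢ k → replaceColumns A j k x y r c ≡ A r c
  replaceColumns-other A {j} x y r c≢j c≢k =
    ≡.trans (replaceColumn-other (replaceColumn A j x) y r c≢k) (replaceColumn-other A x r c≢j)

  replaceColumns-≈M : ∀ {n} {A B : Matrix n n} {j k} {x y} → j ≢ k →
    (∀ r → B r j ≈ x r) → (∀ r → B r k ≈ y r) → (∀ r c → c ≢ j → c ≢ k → B r c ≈ A r c) →
    B ≈M replaceColumns A j k x y
  replaceColumns-≈M {A = A} {B} {j} {k} {x} {y} j≢k Bj≈x Bk≈y B≈A r c with c Fin.≟ k | c Fin.≟ j
  ... | yes ≡.refl | _          = trans (Bk≈y r) (sym (reflexive (replaceColumns-k A x y r)))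
  ... | no c≢k     | yes ≡.refl = trans (Bj≈x r) (sym (reflexive (replaceColumns-j A x y r j≢k)))
  ... | no c≢k     | no c≢j     = trans (B≈A r c c≢j c≢k) (sym (reflexive (replaceColumns-other A x y r c≢j c≢k)))

  -- The Laplace expansion of det along its first two columns, when both equal c;
  -- Ψ h is the determinant of the remaining columns restricted to the rows h.
  expand₂ : ∀ {k} → (Fin (2 ℕ.+ k) → Carrier) → ((Fin k → Fin (2 ℕ.+ k)) → Carrier) → Carrier
  expand₂ c Ψ = altSumF λ r → c r * altSumF λ s → c (punchIn r s) * Ψ (punchIn r ∘ punchIn s)

  -- The terms through row 0 of the two expansion steps cancel.
  expand₂-peel : ∀ {k} (c : Fin (2 ℕ.+ k) → Carrier) (Ψ : (Fin k → Fin (2 ℕ.+ k)) → Carrier) →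
    expand₂ c Ψ ≈ altSumF λ r → c (suc r) * altSumF λ s → c (suc (punchIn r s)) * Ψ (punchIn (suc r) ∘ punchIn (suc s))
  expand₂-peel c Ψ = begin
      c zero * L - altSumF (λ r → c (suc r) * (c zero * Ψ (suc ∘ punchIn r) - R r))
    ≈⟨ +-congˡ (-‿cong (altSumF-cong λ r → trans (x[y-z]≈xy-xz (c (suc r)) _ (R r))
                                                  (+-congʳ (x∙yz≈y∙xz (c (suc r)) (c zero) (Ψ (suc ∘ punchIn r)))))) ⟩
      c zero * L - altSumF (λ r → c zero * (c (suc r) * Ψ (suc ∘ punchIn r)) - c (suc r) * R r)
    ≈⟨ +-congˡ (-‿cong (trans (altSumF-sub (λ r → c zero * l r) (λ r → c (suc r) * R r))
                              (+-congʳ (sym (*-distribˡ-altSumF (c zero) l))))) ⟩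
      c zero * L - (c zero * L - T)
    ≈⟨ +-congˡ (trans (sym (-‿+-comm _ _)) (+-congˡ (-‿involutive T))) ⟩
      c zero * L + (- (c zero * L) + T)
    ≈⟨ trans (sym (+-assoc _ _ _)) (trans (+-congʳ (-‿inverseʳ _)) (+-identityˡ T)) ⟩
      T ∎
    where
    l = λ s → c (suc s) * Ψ (suc ∘ punchIn s)
    L = altSumF l
    R = λ r → altSumF λ s → c (suc (punchIn r s)) * Ψ (punchIn (suc r) ∘ punchIn (suc s))
    T = altSumF λ r → c (suc r) * R r

  expand₂≈0 : ∀ {k} (c : Fin (2 ℕ.+ k) → Carrier) (Ψ : (Fin k → Fin (2 ℕ.+ k)) → Carrier) →
              (∀ {h h′} → h ≗ h′ → Ψ h ≈ Ψ h′) → expand₂ c Ψ ≈ 0#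
  expand₂≈0 {zero}  c Ψ Ψ-cong = trans (expand₂-peel c Ψ) (altSumF-zero λ r → zeroʳ (c (suc r)))
  expand₂≈0 {suc k} c Ψ Ψ-cong = trans (expand₂-peel c Ψ) (trans
    (altSumF-cong λ r → *-congˡ {c (suc r)} (altSumF-cong λ s →
       *-congˡ {c (suc (punchIn r s))} (Ψ-cong (punchIn-suc r s))))
    (expand₂≈0 (c ∘ suc) (Ψ ∘ lift 1) λ h≗h′ → Ψ-cong (lift-cong h≗h′)))
    where
    punchIn-suc : ∀ r s → punchIn (suc r) ∘ punchIn (suc s) ≗ lift 1 (punchIn r ∘ punchIn s)
    punchIn-suc r s zero    = ≡.refl
    punchIn-suc r s (suc t) = ≡.refl
    lift-cong : ∀ {h h′ : Fin k → Fin (2 ℕ.+ k)} → h ≗ h′ → lift 1 h ≗ lift 1 h′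
    lift-cong h≗h′ zero    = ≡.refl
    lift-cong h≗h′ (suc t) = ≡.cong suc (h≗h′ t)

  det-columns01-equal : ∀ {k} (A : Matrix (2 ℕ.+ k) (2 ℕ.+ k)) → (∀ r → A r zero ≈ A r (suc zero)) → det A ≈ 0#
  det-columns01-equal {k} A A₀≈A₁ =
    trans (altSumF-cong λ r → *-congˡ {A r zero} (altSumF-cong λ s →
             *-congʳ {Ψ (punchIn r ∘ punchIn s)} (sym (A₀≈A₁ (punchIn r s)))))
          (expand₂≈0 (λ r → A r zero) Ψ Ψ-cong)
    where
    Ψ : (Fin k → Fin (2 ℕ.+ k)) → Carrier
    Ψ h = det λ a b → A (h a) (suc (suc b))
    Ψ-cong : ∀ {h h′} → h ≗ h′ → Ψ h ≈ Ψ h′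
    Ψ-cong h≗h′ = det-cong λ a b → reflexive (≡.cong (λ r → A r (suc (suc b))) (h≗h′ a))

  Alternating : ℕ → Set (c ⊔ ℓ)
  Alternating n = ∀ (A : Matrix n n) {j k} → j ≢ k → (∀ r → A r j ≈ A r k) → det A ≈ 0#

  alternating⇒swap-negates : ∀ {n} → Alternating n → ∀ (A B : Matrix n n) {j k} → j ≢ k →
    (∀ r → B r j ≈ A r k) → (∀ r → B r k ≈ A r j) → (∀ r c → c ≢ j → c ≢ k → B r c ≈ A r c) →
    det B ≈ - det A
  alternating⇒swap-negates alt A B {j} {k} j≢k Bj≈Ak Bk≈Aj B≈A = +-inverseʳ-unique (det A) (det B) (begin
      det A + det B
    ≈⟨ +-cong (det-cong A≈Muv) (det-cong B≈Mvu) ⟩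
      det (M u v) + det (M v u)
    ≈⟨ +-cong (+-identityˡ _) (+-identityʳ _) ⟨
      (0# + det (M u v)) + (det (M v u) + 0#)
    ≈⟨ +-cong (+-congʳ (M-diag u)) (+-congˡ (M-diag v)) ⟨
      (det (M u u) + det (M u v)) + (det (M v u) + det (M v v))
    ≈⟨ +-cong (det-replaceColumn-+ (replaceColumn A j u) k u v) (det-replaceColumn-+ (replaceColumn A j v) k u v) ⟨
      det (M u u+v) + det (M v u+v)
    ≈⟨ M-additiveˡ u v u+v ⟨
      det (M u+v u+v)
    ≈⟨ M-diag u+v ⟩
      0# ∎)
    where
    M = replaceColumns A j k
    u = λ r → A r j
    v = λ r → A r k
    u+v = λ r → u r + v r
    M-diag : ∀ x → det (M x x) ≈ 0#
    M-diag x = alt (M x x) j≢k λ r →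
      reflexive (≡.trans (replaceColumns-j A x x r j≢k) (≡.sym (replaceColumns-k A x x r)))
    M-commute : ∀ x y → M x y ≈M replaceColumn (replaceColumn A k y) j x
    M-commute x y r c = reflexive (updateAt-commutes k j (j≢k ∘ ≡.sym) (A r) c)
    M-additiveˡ : ∀ x y z → det (M (λ r → x r + y r) z) ≈ det (M x z) + det (M y z)
    M-additiveˡ x y z = trans (det-cong (M-commute _ z)) (trans (det-replaceColumn-+ (replaceColumn A k z) j x y)
      (sym (+-cong (det-cong (M-commute x z)) (det-cong (M-commute y z)))))
    A≈Muv : A ≈M M u v
    A≈Muv = replaceColumns-≈M j≢k (λ r → refl) (λ r → refl) (λ r c _ _ → refl)
    B≈Mvu : B ≈M M v u
    B≈Mvu = replaceColumns-≈M j≢k Bj≈Ak Bk≈Aj B≈A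

  -- Swapping the columns 1 and suc (suc k) of A swaps the columns 0 and suc k of every minor, which negates
  -- the determinant by alternation in size n, and produces equal columns 0 and 1.
  det-column0≈column : ∀ {n} → Alternating n → ∀ (A : Matrix (suc n) (suc n)) k →
    (∀ r → A r zero ≈ A r (suc k)) → det A ≈ 0#
  det-column0≈column alt A zero    A₀≈A₁ = det-columns01-equal A A₀≈A₁
  det-column0≈column alt A (suc k) A₀≈Aₖ = begin
      det A      ≈⟨ -‿involutive (det A) ⟨
      - - det A  ≈⟨ -‿cong detB≈-detA ⟨
      - det B    ≈⟨ -‿cong (det-columns01-equal B A₀≈Aₖ) ⟩
      - 0#       ≈⟨ -0#≈0# ⟩
      0#         ∎
    where
    K = suc (suc k)
    colK = λ r → A r K
    col1 = λ r → A r (suc zero)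
    B = replaceColumns A (suc zero) K colK col1
    detB≈-detA : det B ≈ - det A
    detB≈-detA = trans
      (altSumF-cong λ r → trans
        (*-congˡ (alternating⇒swap-negates alt (minor r A) (minor r B) {zero} {suc k} (λ ()) (λ a → refl)
          (λ a → reflexive (replaceColumns-k A {suc zero} {K} colK col1 (punchIn r a)))
          (λ a c c≢0 c≢k → reflexive (replaceColumns-other A {suc zero} {K} colK col1 (punchIn r a)
                                                           (c≢0 ∘ suc-injective) (c≢k ∘ suc-injective)))))
        (sym (-‿distribʳ-* (A r zero) (det (minor r A)))))
      (altSumF-neg λ r → A r zero * det (minor r A))

  det-alternating : ∀ {n} → Alternating n
  det-alternating {suc n} A {zero}  {zero}  0≢0 _     = ⊥-elim (0≢0 ≡.refl)
  det-alternating {suc n} A {zero}  {suc k} _   A₀≈Aₖ = det-column0≈column det-alternating A k A₀≈Aₖ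
  det-alternating {suc n} A {suc j} {zero}  _   Aⱼ≈A₀ = det-column0≈column det-alternating A j (sym ∘ Aⱼ≈A₀)
  det-alternating {suc n} A {suc j} {suc k} j≢k Aⱼ≈Aₖ = altSumF-zero λ r →
    trans (*-congˡ (det-alternating (minor r A) (j≢k ∘ ≡.cong suc) (Aⱼ≈Aₖ ∘ punchIn r))) (zeroʳ (A r zero))

  det-zero-row : ∀ {n} (A : Matrix n n) r → (∀ c → A r c ≈ 0#) → det A ≈ 0#
  det-minor-zero-row : ∀ {n} (A : Matrix (suc n) (suc n)) {r s} → s ≢ r → (∀ c → A r (suc c) ≈ 0#) →
                       det (minor s A) ≈ 0#

  det-zero-row {suc n} A r Aᵣ≈0 = altSumF-zero term
    where
    term : ∀ s → A s zero * det (minor s A) ≈ 0#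
    term s with s Fin.≟ r
    ... | yes ≡.refl = trans (*-congʳ (Aᵣ≈0 zero)) (zeroˡ _)
    ... | no s≢r     = trans (*-congˡ (det-minor-zero-row A s≢r (Aᵣ≈0 ∘ suc))) (zeroʳ _)

  det-minor-zero-row A {r} {s} s≢r Aᵣ≈0 = det-zero-row (minor s A) (punchOut s≢r) λ c →
    trans (reflexive (≡.cong (λ t → A t (suc c)) (punchIn-punchOut s≢r))) (Aᵣ≈0 c)

  det-addColumnMultiple : ∀ {n} (A : Matrix n n) {j k} → j ≢ k → ∀ x →
    det (replaceColumn A k (λ r → A r k + x * A r j)) ≈ det A
  det-addColumnMultiple A {j} {k} j≢k x = begin
      det (replaceColumn A k (λ r → A r k + x * A r j))
    ≈⟨ det-replaceColumn-+ A k (λ r → A r k) (λ r → x * A r j) ⟩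
      det (replaceColumn A k (λ r → A r k)) + det (replaceColumn A k (λ r → x * A r j))
    ≈⟨ +-cong (det-cong (replaceColumn-self A k)) (det-replaceColumn-* A k x colⱼ) ⟩
      det A + x * det (replaceColumn A k colⱼ)
    ≈⟨ +-congˡ (trans (*-congˡ (det-alternating _ j≢k colⱼ-repeated)) (zeroʳ x)) ⟩
      det A + 0#
    ≈⟨ +-identityʳ _ ⟩
      det A ∎
    where
    colⱼ = λ r → A r j
    colⱼ-repeated : ∀ r → replaceColumn A k colⱼ r j ≈ replaceColumn A k colⱼ r k
    colⱼ-repeated r = reflexive (≡.trans (replaceColumn-other A colⱼ r j≢k) (≡.sym (replaceColumn-same A k colⱼ r)))

  addColumn0Multiples : ∀ {m} → Matrix (suc m) (suc m) → (Fin m → Carrier) → Matrix (suc m) (suc m)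
  addColumn0Multiples A τ r zero    = A r zero
  addColumn0Multiples A τ r (suc c) = A r (suc c) + τ c * A r zero

  -- Induction on a bound K for the modified columns, adding one column multiple at a time.
  det-addColumn0Multiples : ∀ {m} (A : Matrix (suc m) (suc m)) τ → det (addColumn0Multiples A τ) ≈ det A
  det-addColumn0Multiples {m} A τ = go m τ λ c m≤c → ⊥-elim (ℕ.<⇒≱ (toℕ<n c) m≤c)
    where
    go : ∀ K τ → (∀ c → K ℕ.≤ toℕ c → τ c ≈ 0#) → det (addColumn0Multiples A τ) ≈ det A
    go zero    τ τ≈0 = det-cong {A = addColumn0Multiples A τ} {B = A} λ where
      r zero    → refl
      r (suc c) → trans (+-congˡ (trans (*-congʳ (τ≈0 c z≤n)) (zeroˡ _))) (+-identityʳ _)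
    go (suc K) τ τ≈0 with K ℕ.<? m
    ... | no K≮m  = go K τ λ c K≤c → ⊥-elim (K≮m (ℕ.≤-<-trans K≤c (toℕ<n c)))
    ... | yes K<m = begin
        det (addColumn0Multiples A τ)
      ≈⟨ det-cong step ⟩
        det (replaceColumn A′ (suc k) v)
      ≈⟨ det-addColumnMultiple A′ {zero} {suc k} (λ ()) (τ k) ⟩
        det A′
      ≈⟨ go K τ′ τ′≈0 ⟩
        det A ∎
      where
      k = fromℕ< K<m
      τ′ = updateAt τ k (const 0#)
      A′ = addColumn0Multiples A τ′
      v = λ r → A′ r (suc k) + τ k * A′ r zero
      τ′≈0 : ∀ c → K ℕ.≤ toℕ c → τ′ c ≈ 0#
      τ′≈0 c K≤c with c Fin.≟ k
      ... | yes ≡.refl = reflexive (updateAt-updates k τ)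
      ... | no c≢k     = trans (reflexive (updateAt-minimal c k τ c≢k)) (τ≈0 c (ℕ.≤∧≢⇒< K≤c λ K≡c →
                           c≢k (toℕ-injective (≡.trans (≡.sym K≡c) (≡.sym (toℕ-fromℕ< K<m))))))
      step : addColumn0Multiples A τ ≈M replaceColumn A′ (suc k) v
      step r zero    = refl
      step r (suc c) with c Fin.≟ k
      ... | yes ≡.refl = sym (trans (reflexive (replaceColumn-same A′ (suc k) v r))
                           (+-congʳ (trans (+-congˡ (trans (*-congʳ (reflexive (updateAt-updates k τ))) (zeroˡ _)))
                                           (+-identityʳ _))))
      ... | no c≢k     = sym (trans (reflexive (replaceColumn-other A′ v r (c≢k ∘ suc-injective)))
                           (+-congˡ (*-congʳ (reflexive (updateAt-minimal c k τ c≢k)))))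

  -- Kernels

  infixr 7 _*ᵥ_
  _*ᵥ_ : ∀ {m k} → Matrix m k → (Fin k → Carrier) → Fin m → Carrier
  (A *ᵥ x) a = sumF λ t → A a t * x t

  TrivialKernel : ∀ {m k} → Matrix m k → Set (c ⊔ ℓ)
  TrivialKernel A = ∀ x → (∀ a → (A *ᵥ x) a ≈ 0#) → ∀ t → x t ≈ 0#

  -- Cramer: replacing column t of A by A x multiplies det A by x t.
  det≉0⇒trivialKernel : ∀ {n} (A : Matrix n n) → det A ≉ 0# → TrivialKernel A
  det≉0⇒trivialKernel A det≉0 x Ax≈0 t = x≉0∧x*y≈0⇒y≈0 det≉0 (begin
      det A * x t
    ≈⟨ *-comm (det A) (x t) ⟩
      x t * det A
    ≈⟨ *-congˡ (det-cong (replaceColumn-self A t)) ⟨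
      x t * det (replaceColumn A t (column t))
    ≈⟨ sumF-single (λ b → x b * det (replaceColumn A t (column b))) t other-terms ⟨
      sumF (λ b → x b * det (replaceColumn A t (column b)))
    ≈⟨ det-replaceColumn-sumF A t x column ⟨
      det (replaceColumn A t (λ r → sumF λ b → x b * A r b))
    ≈⟨ det-replaceColumn-zero A t (λ r → trans (sumF-cong λ b → *-comm (x b) (A r b)) (Ax≈0 r)) ⟩
      0# ∎)
    where
    column = λ b r → A r b
    other-terms : ∀ b → b ≢ t → x b * det (replaceColumn A t (column b)) ≈ 0#
    other-terms b b≢t = trans (*-congˡ (det-alternating _ (b≢t ∘ ≡.sym) λ r → reflexive
      (≡.trans (replaceColumn-same A t (column b) r) (≡.sym (replaceColumn-other A (column b) r b≢t))))) (zeroʳ (x b))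

  -- Gaussian elimination on a pivot in column 0, under a double negation since equality in E is not decidable.
  trivialKernel⇒det≉0 : ∀ {n} (A : Matrix n n) → TrivialKernel A → det A ≉ 0#
  trivialKernel⇒det≉0 {zero}  A _   = 1≉0
  trivialKernel⇒det≉0 {suc m} A ker detA≈0 = ¬¬-∀-Fin pivot column0≉0
    where
    e₀ : Fin (suc m) → Carrier
    e₀ zero    = 1#
    e₀ (suc _) = 0#
    column0≉0 : ¬ (∀ r → A r zero ≈ 0#)
    column0≉0 A₀≈0 = 1≉0 (ker e₀ (λ a → trans (+-cong (trans (*-identityʳ _) (A₀≈0 a))
                                                      (sumF-zero λ t → zeroʳ (A a (suc t))))
                                             (+-identityˡ 0#)) zero)
    pivot : ∀ r → ¬ ¬ (A r zero ≈ 0#)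
    pivot r Aᵣ₀≉0 = trivialKernel⇒det≉0 (minor r B) minor-ker det-minor≈0
      where
      p⁻¹ = proj₁ (inverse (A r zero) Aᵣ₀≉0)
      p⁻¹p≈1 : p⁻¹ * A r zero ≈ 1#
      p⁻¹p≈1 = trans (*-comm _ _) (proj₂ (inverse (A r zero) Aᵣ₀≉0))
      τ = λ c → - (A r (suc c) * p⁻¹)
      B = addColumn0Multiples A τ
      row-r : ∀ c → B r (suc c) ≈ 0#
      row-r c = begin
        A r (suc c) + - (A r (suc c) * p⁻¹) * A r zero  ≈⟨ +-congˡ (-‿distribˡ-* _ _) ⟨
        A r (suc c) - A r (suc c) * p⁻¹ * A r zero      ≈⟨ +-congˡ (-‿cong (trans (*-assoc _ p⁻¹ _) (*-congˡ p⁻¹p≈1))) ⟩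
        A r (suc c) - A r (suc c) * 1#                  ≈⟨ +-congˡ (-‿cong (*-identityʳ _)) ⟩
        A r (suc c) - A r (suc c)                       ≈⟨ -‿inverseʳ _ ⟩
        0#                                              ∎
      det-minor≈0 : det (minor r B) ≈ 0#
      det-minor≈0 = x≉0∧x*y≈0⇒y≈0 Aᵣ₀≉0 (altSumF-isolate (λ s → B s zero * det (minor s B)) r
        (λ s s≢r → trans (*-congˡ (det-minor-zero-row B s≢r row-r)) (zeroʳ _))
        (trans (det-addColumn0Multiples A τ) detA≈0))
      minor-ker : TrivialKernel (minor r B)
      minor-ker y By≈0 c = ker x̂ Ax̂≈0 (suc c)
        where
        x̂ : Fin (suc m) → Carrier
        x̂ zero    = sumF λ c → τ c * y c
        x̂ (suc c) = y c
        Ax̂≈0 : ∀ s → (A *ᵥ x̂) s ≈ 0#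
        Ax̂≈0 s = begin
            A s zero * sumF (λ c → τ c * y c) + sumF (λ c → A s (suc c) * y c)
          ≈⟨ +-congʳ (trans (*-distribˡ-sumF (A s zero) (λ c → τ c * y c))
                            (sumF-cong λ c → trans (x∙yz≈y∙xz (A s zero) (τ c) (y c))
                                                   (sym (*-assoc (τ c) (A s zero) (y c))))) ⟩
            sumF (λ c → τ c * A s zero * y c) + sumF (λ c → A s (suc c) * y c)
          ≈⟨ sumF-+ (λ c → τ c * A s zero * y c) (λ c → A s (suc c) * y c) ⟨
            sumF (λ c → τ c * A s zero * y c + A s (suc c) * y c)
          ≈⟨ sumF-cong (λ c → trans (+-comm _ _) (sym (distribʳ (y c) (A s (suc c)) (τ c * A s zero)))) ⟩
            sumF (λ c → B s (suc c) * y c)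
          ≈⟨ B0y≈0 s ⟩
            0# ∎
          where
          B0y≈0 : ∀ s → sumF (λ c → B s (suc c) * y c) ≈ 0#
          B0y≈0 s with s Fin.≟ r
          ... | yes ≡.refl = sumF-zero λ c → trans (*-congʳ (row-r c)) (zeroˡ _)
          ... | no s≢r     = trans (sumF-cong λ c → reflexive
                                     (≡.cong (λ t → B t (suc c) * y c) (≡.sym (punchIn-punchOut r≢s))))
                                   (By≈0 (punchOut r≢s))
            where r≢s = s≢r ∘ ≡.sym

  trivialKernel⇔det≉0 : ∀ {n} (A : Matrix n n) → TrivialKernel A ⇔ det A ≉ 0#
  trivialKernel⇔det≉0 A = mk⇔ (trivialKernel⇒det≉0 A) (det≉0⇒trivialKernel A)

  *ᵥ-cong : ∀ {m k} {A B : Matrix m k} {x y : Fin k → Carrier} → A ≈M B → (∀ t → x t ≈ y t) →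
            ∀ a → (A *ᵥ x) a ≈ (B *ᵥ y) a
  *ᵥ-cong A≈B x≈y a = sumF-cong λ t → *-cong (A≈B a t) (x≈y t)

  *ᵥ-zero : ∀ {m k} (A : Matrix m k) {x} → (∀ t → x t ≈ 0#) → ∀ a → (A *ᵥ x) a ≈ 0#
  *ᵥ-zero A x≈0 a = sumF-zero λ t → trans (*-congˡ (x≈0 t)) (zeroʳ (A a t))

  ·-*ᵥ : ∀ {m k l} (A : Matrix m k) (B : Matrix k l) x a → ((A · B) *ᵥ x) a ≈ (A *ᵥ (B *ᵥ x)) a
  ·-*ᵥ A B x a = begin
      sumF (λ t → sumF (λ s → A a s * B s t) * x t)
    ≈⟨ sumF-cong (λ t → trans (*-distribʳ-sumF (x t) λ s → A a s * B s t)
                              (sumF-cong λ s → *-assoc (A a s) (B s t) (x t))) ⟩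
      sumF (λ t → sumF (λ s → A a s * (B s t * x t)))
    ≈⟨ sumF-comm (λ t s → A a s * (B s t * x t)) ⟩
      sumF (λ s → sumF (λ t → A a s * (B s t * x t)))
    ≈⟨ sumF-cong (λ s → sym (*-distribˡ-sumF (A a s) λ t → B s t * x t)) ⟩
      sumF (λ s → A a s * sumF (λ t → B s t * x t)) ∎

  idM-diag : ∀ {n} (a : Fin n) → idM a a ≈ 1#
  idM-diag a = reflexive (≡.cong (λ b → if b then 1# else 0#) (dec-true (a Fin.≟ a) ≡.refl))

  idM-off : ∀ {n} {a b : Fin n} → a ≢ b → idM a b ≈ 0#
  idM-off {a = a} {b} a≢b = reflexive (≡.cong (λ b → if b then 1# else 0#) (dec-false (a Fin.≟ b) a≢b))

  basis : ∀ {n} → Fin n → Fin n → Carrier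
  basis j t = idM t j

  *ᵥ-basis : ∀ {m n} (A : Matrix m n) j a → (A *ᵥ basis j) a ≈ A a j
  *ᵥ-basis A j a = trans (sumF-single (λ t → A a t * idM t j) j λ t t≢j → trans (*-congˡ (idM-off t≢j)) (zeroʳ _))
                         (trans (*-congˡ (idM-diag j)) (*-identityʳ _))

  idM-*ᵥ : ∀ {n} x (a : Fin n) → (idM *ᵥ x) a ≈ x a
  idM-*ᵥ x a = trans (sumF-single (λ t → idM a t * x t) a λ t t≢a →
                       trans (*-congʳ (idM-off (t≢a ∘ ≡.sym))) (zeroˡ _))
                     (trans (*-congʳ (idM-diag a)) (*-identityˡ _))

  leftInverse-*ᵥ : ∀ {n} {A B : Matrix n n} → B · A ≈M idM → ∀ x a → (B *ᵥ (A *ᵥ x)) a ≈ x a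
  leftInverse-*ᵥ {A = A} {B} BA≈I x a = trans (sym (·-*ᵥ B A x a)) (trans (*ᵥ-cong BA≈I (λ _ → refl) a) (idM-*ᵥ x a))

  invertible⇒trivialKernel : ∀ {n} (A : Matrix n n) → Invertible A → TrivialKernel A
  invertible⇒trivialKernel A (B , _ , BA≈I) x Ax≈0 t = trans (sym (leftInverse-*ᵥ BA≈I x t)) (*ᵥ-zero B Ax≈0 t)

  trivialKernel⇒injective : ∀ {m k} (A : Matrix m k) → TrivialKernel A → ∀ {x y} →
    (∀ a → (A *ᵥ x) a ≈ (A *ᵥ y) a) → ∀ t → x t ≈ y t
  trivialKernel⇒injective A ker {x} {y} Ax≈Ay t = x∙y⁻¹≈ε⇒x≈y _ _ (ker (λ t → x t - y t) A[x-y]≈0 t)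
    where
    A[x-y]≈0 : ∀ a → (A *ᵥ (λ t → x t - y t)) a ≈ 0#
    A[x-y]≈0 a = begin
        sumF (λ t → A a t * (x t - y t))
      ≈⟨ sumF-cong (λ t → x[y-z]≈xy-xz (A a t) (x t) (y t)) ⟩
        sumF (λ t → A a t * x t - A a t * y t)
      ≈⟨ trans (sumF-+ (λ t → A a t * x t) (λ t → - (A a t * y t))) (+-congˡ (sumF-neg λ t → A a t * y t)) ⟩
        (A *ᵥ x) a - (A *ᵥ y) a
      ≈⟨ +-congʳ (Ax≈Ay a) ⟩
        (A *ᵥ y) a - (A *ᵥ y) a
      ≈⟨ -‿inverseʳ _ ⟩
        0# ∎

  -- Triangular matrices and Bruhat cells

  VanishesFrom : ∀ {n} → ℕ → (Fin n → Carrier) → Set ℓ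
  VanishesFrom k x = ∀ t → k ℕ.≤ toℕ t → x t ≈ 0#

  basis-vanishes : ∀ {n} (j : Fin n) → VanishesFrom (suc (toℕ j)) (basis j)
  basis-vanishes j t j<t = idM-off λ t≡j → ℕ.<-irrefl (≡.cong toℕ (≡.sym t≡j)) j<t

  upperTriangular-*ᵥ : ∀ {n} {B : Matrix n n} → UpperTriangular B → ∀ {k x} →
                       VanishesFrom k x → VanishesFrom k (B *ᵥ x)
  upperTriangular-*ᵥ {B = B} B-ut {k} {x} x≈0 a k≤a = sumF-zero term
    where
    term : ∀ t → B a t * x t ≈ 0#
    term t with toℕ t ℕ.<? toℕ a
    ... | yes t<a = trans (*-congʳ (B-ut a t t<a)) (zeroˡ _)
    ... | no  t≮a = trans (*-congˡ (x≈0 t (ℕ.≤-trans k≤a (ℕ.≮⇒≥ t≮a)))) (zeroʳ _)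

  -- Descending induction on the row s: the rows of B below s being known, row s of b · B = idM
  -- only involves the diagonal entry b s s.
  rightInverse-upperTriangular : ∀ {n} {b B : Matrix n n} → UpperTriangular b → b · B ≈M idM → UpperTriangular B
  rightInverse-upperTriangular {n} {b} {B} b-ut bB≈I = All.wfRec >-wellFounded ℓ RowVanishes step
    where
    RowVanishes : Fin n → Set ℓ
    RowVanishes s = ∀ j → toℕ j ℕ.< toℕ s → B s j ≈ 0#
    step : ∀ s → (∀ {t} → t Fin.> s → RowVanishes t) → RowVanishes s
    step s below j j<s =
      x≉0∧x*y≈0⇒y≈0 bₛₛ≉0 (trans (sym (row-s j (ℕ.<⇒≤ j<s))) (trans (bB≈I s j) (idM-off s≢j)))
      where
      s≢j : s ≢ j
      s≢j s≡j = ℕ.<-irrefl (≡.cong toℕ (≡.sym s≡j)) j<s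
      row-s : ∀ j → toℕ j ℕ.≤ toℕ s → (b · B) s j ≈ b s s * B s j
      row-s j j≤s = sumF-single (λ t → b s t * B t j) s off-diagonal
        where
        off-diagonal : ∀ t → t ≢ s → b s t * B t j ≈ 0#
        off-diagonal t t≢s with ℕ.<-cmp (toℕ t) (toℕ s)
        ... | tri< t<s _ _ = trans (*-congʳ (b-ut s t t<s)) (zeroˡ _)
        ... | tri≈ _ t≡s _ = ⊥-elim (t≢s (toℕ-injective t≡s))
        ... | tri> _ _ s<t = trans (*-congˡ (below s<t j (ℕ.≤-<-trans j≤s s<t))) (zeroʳ _)
      bₛₛ≉0 : b s s ≉ 0#
      bₛₛ≉0 bₛₛ≈0 = 1≉0 (begin
        1#              ≈⟨ idM-diag s ⟨
        idM s s         ≈⟨ bB≈I s s ⟨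
        (b · B) s s     ≈⟨ row-s s ℕ.≤-refl ⟩
        b s s * B s s   ≈⟨ *-congʳ bₛₛ≈0 ⟩
        0# * B s s      ≈⟨ zeroˡ _ ⟩
        0#              ∎)

  SpanMeetsTrivially : ∀ {n} → Matrix n n → ℕ → ℕ → Set (c ⊔ ℓ)
  SpanMeetsTrivially g m i = ∀ x → VanishesFrom m x → VanishesFrom i (g *ᵥ x) → ∀ a → (g *ᵥ x) a ≈ 0#

  module BruhatCell {n} {g : Matrix n n} {w : Fin n → Fin n} (g∈BẇB : InBruhatCell g w) where

    private
      b₁ b₂ : Matrix n n
      b₁ = proj₁ g∈BẇB
      b₂ = proj₁ (proj₂ g∈BẇB)
      b₁∈B : InBorel b₁
      b₁∈B = proj₁ (proj₂ (proj₂ g∈BẇB))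
      b₂∈B : InBorel b₂
      b₂∈B = proj₁ (proj₂ (proj₂ (proj₂ g∈BẇB)))
      g≈b₁ẇb₂ : g ≈M (b₁ · permMatrix w · b₂)
      g≈b₁ẇb₂ = proj₂ (proj₂ (proj₂ (proj₂ g∈BẇB)))
      b₁-ut = proj₁ b₁∈B
      b₂-ut = proj₁ b₂∈B
      B₁ = proj₁ (proj₂ b₁∈B)
      B₂ = proj₁ (proj₂ b₂∈B)
      B₁-ut : UpperTriangular B₁
      B₁-ut = rightInverse-upperTriangular b₁-ut (proj₁ (proj₂ (proj₂ b₁∈B)))
      B₂-ut : UpperTriangular B₂
      B₂-ut = rightInverse-upperTriangular b₂-ut (proj₁ (proj₂ (proj₂ b₂∈B)))
      b₂B₂-*ᵥ : ∀ x t → (b₂ *ᵥ (B₂ *ᵥ x)) t ≈ x t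
      b₂B₂-*ᵥ = leftInverse-*ᵥ (proj₁ (proj₂ (proj₂ b₂∈B)))
      B₁b₁-*ᵥ : ∀ x t → (B₁ *ᵥ (b₁ *ᵥ x)) t ≈ x t
      B₁b₁-*ᵥ = leftInverse-*ᵥ (proj₂ (proj₂ (proj₂ b₁∈B)))

    g-*ᵥ : ∀ x a → (g *ᵥ x) a ≈ (b₁ *ᵥ (permMatrix w *ᵥ (b₂ *ᵥ x))) a
    g-*ᵥ x a = trans (*ᵥ-cong g≈b₁ẇb₂ (λ _ → refl) a)
                     (trans (·-*ᵥ (b₁ · permMatrix w) b₂ x a) (·-*ᵥ b₁ (permMatrix w) (b₂ *ᵥ x) a))

    g-*ᵥ-B₂eⱼ : ∀ j a → (g *ᵥ (B₂ *ᵥ basis j)) a ≈ b₁ a (w j)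
    g-*ᵥ-B₂eⱼ j a = begin
        (g *ᵥ (B₂ *ᵥ basis j)) a
      ≈⟨ g-*ᵥ _ a ⟩
        (b₁ *ᵥ (permMatrix w *ᵥ (b₂ *ᵥ (B₂ *ᵥ basis j)))) a
      ≈⟨ *ᵥ-cong {A = b₁} (λ _ _ → refl) (*ᵥ-cong {A = permMatrix w} (λ _ _ → refl) (b₂B₂-*ᵥ (basis j))) a ⟩
        (b₁ *ᵥ (permMatrix w *ᵥ basis j)) a
      ≈⟨ *ᵥ-cong {A = b₁} (λ _ _ → refl) (*ᵥ-basis (permMatrix w) j) a ⟩
        (b₁ *ᵥ basis (w j)) a
      ≈⟨ *ᵥ-basis b₁ (w j) a ⟩
        b₁ a (w j) ∎

    w-injective : TrivialKernel g → ∀ {j j′} → w j ≡ w j′ → j ≡ j′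
    w-injective g-ker {j} {j′} wj≡wj′ with j Fin.≟ j′
    ... | yes j≡j′ = j≡j′
    ... | no  j≢j′ = ⊥-elim (1≉0 (begin
        1#         ≈⟨ idM-diag j ⟨
        idM j j    ≈⟨ eⱼ≈eⱼ′ j ⟩
        idM j j′   ≈⟨ idM-off j≢j′ ⟩
        0#         ∎))
      where
      B₂eⱼ≈B₂eⱼ′ : ∀ t → (B₂ *ᵥ basis j) t ≈ (B₂ *ᵥ basis j′) t
      B₂eⱼ≈B₂eⱼ′ = trivialKernel⇒injective g g-ker λ a →
        trans (g-*ᵥ-B₂eⱼ j a) (trans (reflexive (≡.cong (b₁ a) wj≡wj′)) (sym (g-*ᵥ-B₂eⱼ j′ a)))
      eⱼ≈eⱼ′ : ∀ t → basis j t ≈ basis j′ t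
      eⱼ≈eⱼ′ t = trans (sym (b₂B₂-*ᵥ (basis j) t))
                       (trans (*ᵥ-cong {A = b₂} (λ _ _ → refl) B₂eⱼ≈B₂eⱼ′ t) (b₂B₂-*ᵥ (basis j′) t))

    spanMeetsTrivially⇒mapsPrefixAbove : ∀ {m i} → SpanMeetsTrivially g m i → MapsPrefixAbove w m i
    spanMeetsTrivially⇒mapsPrefixAbove {m} {i} meets j j<m with i ℕ.≤? toℕ (w j)
    ... | yes i≤wj = i≤wj
    ... | no  i≰wj = ⊥-elim (1≉0 (begin
        1#                    ≈⟨ idM-diag (w j) ⟨
        basis (w j) (w j)     ≈⟨ invertible⇒trivialKernel b₁ (proj₂ b₁∈B) (basis (w j)) b₁eₖ≈0 (w j) ⟩
        0#                    ∎))
      where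
      x = B₂ *ᵥ basis j
      x-vanishes : VanishesFrom m x
      x-vanishes t m≤t = upperTriangular-*ᵥ B₂-ut (basis-vanishes j) t (ℕ.≤-trans j<m m≤t)
      b₁-column≈0 : ∀ a → b₁ a (w j) ≈ 0#
      b₁-column≈0 a = trans (sym (g-*ᵥ-B₂eⱼ j a)) (meets x x-vanishes (λ a i≤a →
        trans (g-*ᵥ-B₂eⱼ j a) (b₁-ut a (w j) (ℕ.<-≤-trans (ℕ.≰⇒> i≰wj) i≤a))) a)
      b₁eₖ≈0 : ∀ a → (b₁ *ᵥ basis (w j)) a ≈ 0#
      b₁eₖ≈0 a = trans (*ᵥ-basis b₁ (w j) a) (b₁-column≈0 a)

    -- With z = ẇ b₂ x, the vector z vanishes below i because of where w sends [0, m),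
    -- and from i on because b₁ z = g x does.
    mapsPrefixAbove⇒spanMeetsTrivially : ∀ {m i} → MapsPrefixAbove w m i → SpanMeetsTrivially g m i
    mapsPrefixAbove⇒spanMeetsTrivially {m} {i} maps x x-vanishes gx-vanishes a =
      trans (g-*ᵥ x a) (*ᵥ-zero b₁ z≈0 a)
      where
      y = b₂ *ᵥ x
      z = permMatrix w *ᵥ y
      z-low : ∀ a → toℕ a ℕ.< i → z a ≈ 0#
      z-low a a<i = sumF-zero term
        where
        term : ∀ t → permMatrix w a t * y t ≈ 0#
        term t with a Fin.≟ w t | toℕ t ℕ.<? m
        ... | no  _    | _       = zeroˡ _
        ... | yes a≡wt | yes t<m = ⊥-elim (ℕ.<⇒≱ a<i (≡.subst (λ b → i ℕ.≤ toℕ b) (≡.sym a≡wt) (maps t t<m)))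
        ... | yes _    | no  t≮m = trans (*-congˡ (upperTriangular-*ᵥ b₂-ut x-vanishes t (ℕ.≮⇒≥ t≮m))) (zeroʳ _)
      z-high : VanishesFrom i z
      z-high a i≤a = trans (sym (B₁b₁-*ᵥ z a)) (upperTriangular-*ᵥ B₁-ut b₁z-vanishes a i≤a)
        where
        b₁z-vanishes : VanishesFrom i (b₁ *ᵥ z)
        b₁z-vanishes a i≤a = trans (sym (g-*ᵥ x a)) (gx-vanishes a i≤a)
      z≈0 : ∀ a → z a ≈ 0#
      z≈0 a with toℕ a ℕ.<? i
      ... | yes a<i = z-low a a<i
      ... | no  a≮i = z-high a (ℕ.≮⇒≥ a≮i)

    spanMeetsTrivially⇔mapsPrefixAbove : ∀ m i → SpanMeetsTrivially g m i ⇔ MapsPrefixAbove w m i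
    spanMeetsTrivially⇔mapsPrefixAbove m i = mk⇔ spanMeetsTrivially⇒mapsPrefixAbove mapsPrefixAbove⇒spanMeetsTrivially

  -- Submatrices

  leadingColumns : ∀ {n m} → m ℕ.≤ n → Matrix n n → Matrix n m
  leadingColumns m≤n A r b = A r (inject≤ b m≤n)

  private
    pad : ∀ {m t} → (Fin m → Carrier) → Dec (t ℕ.< m) → Carrier
    pad x (yes t<m) = x (fromℕ< t<m)
    pad x (no  _)   = 0#

  extendByZero : ∀ {n m} → m ℕ.≤ n → (Fin m → Carrier) → Fin n → Carrier
  extendByZero {m = m} m≤n x t = pad x (toℕ t ℕ.<? m)

  extendByZero-inject≤ : ∀ {n m} (m≤n : m ℕ.≤ n) x b → extendByZero m≤n x (inject≤ b m≤n) ≈ x b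
  extendByZero-inject≤ {m = m} m≤n x b = at-b (toℕ (inject≤ b m≤n) ℕ.<? m)
    where
    at-b : (d : Dec (toℕ (inject≤ b m≤n) ℕ.< m)) → pad x d ≈ x b
    at-b (yes b<m) = reflexive (≡.cong x (toℕ-injective (≡.trans (toℕ-fromℕ< b<m) (toℕ-inject≤ b m≤n))))
    at-b (no  b≮m) = ⊥-elim (b≮m (≡.subst (ℕ._< m) (≡.sym (toℕ-inject≤ b m≤n)) (toℕ<n b)))

  extendByZero-vanishes : ∀ {n m} (m≤n : m ℕ.≤ n) x → VanishesFrom m (extendByZero {n} m≤n x)
  extendByZero-vanishes {m = m} m≤n x t m≤t = beyond (toℕ t ℕ.<? m)
    where
    beyond : (d : Dec (toℕ t ℕ.< m)) → pad x d ≈ 0#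
    beyond (yes t<m) = ⊥-elim (ℕ.<⇒≱ t<m m≤t)
    beyond (no  _)   = refl

  *ᵥ-vanishesFrom : ∀ {n m} (m≤n : m ℕ.≤ n) (A : Matrix n n) {x} → VanishesFrom m x →
    ∀ r → (A *ᵥ x) r ≈ (leadingColumns m≤n A *ᵥ (λ b → x (inject≤ b m≤n))) r
  *ᵥ-vanishesFrom m≤n A x≈0 r = sumF-inject≤ m≤n _ λ t m≤t → trans (*-congˡ (x≈0 t m≤t)) (zeroʳ _)

  *ᵥ-extendByZero : ∀ {n m} (m≤n : m ℕ.≤ n) (A : Matrix n n) x r →
    (A *ᵥ extendByZero m≤n x) r ≈ (leadingColumns m≤n A *ᵥ x) r
  *ᵥ-extendByZero m≤n A x r = trans (*ᵥ-vanishesFrom m≤n A (extendByZero-vanishes m≤n x) r)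
    (sumF-cong λ b → *-congˡ (extendByZero-inject≤ m≤n x b))

  leadingColumns-trivialKernel : ∀ {n m} (m≤n : m ℕ.≤ n) {A : Matrix n n} → TrivialKernel A →
                                 TrivialKernel (leadingColumns m≤n A)
  leadingColumns-trivialKernel m≤n {A} A-ker x Aₘx≈0 b = trans (sym (extendByZero-inject≤ m≤n x b))
    (A-ker (extendByZero m≤n x) (λ r → trans (*ᵥ-extendByZero m≤n A x r) (Aₘx≈0 r)) (inject≤ b m≤n))

  ImageMeetsTrivially : ∀ {n m} → Matrix n m → (Fin n → Set) → Set (c ⊔ ℓ)
  ImageMeetsTrivially M Z = ∀ x → (∀ r → Z r → (M *ᵥ x) r ≈ 0#) → ∀ r → (M *ᵥ x) r ≈ 0#

  imageMeetsTrivially⇔ : ∀ {n m} (M : Matrix n m) (Z : Fin n → Set) →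
    (∀ v → (∃ λ x → ∀ r → v r ≈ (M *ᵥ x) r) → (∀ r → Z r → v r ≈ 0#) → ∀ r → v r ≈ 0#)
      ⇔ ImageMeetsTrivially M Z
  imageMeetsTrivially⇔ M Z = mk⇔
    (λ meets x Mx≈0 → meets (M *ᵥ x) (x , λ r → refl) Mx≈0)
    (λ meets v (x , v≈Mx) v≈0 r → trans (v≈Mx r) (meets x (λ r z → trans (sym (v≈Mx r)) (v≈0 r z)) r))

  selectRows-trivialKernel⇔ : ∀ {n m k} {M : Matrix n m} {Z : Fin n → Set} {ι : Fin k → Fin n} → TrivialKernel M →
    (∀ a → Z (ι a)) → (∀ r → Z r → ∃ λ a → ι a ≡ r) →
    TrivialKernel (λ a b → M (ι a) b) ⇔ ImageMeetsTrivially M Z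
  selectRows-trivialKernel⇔ {M = M} {Z} {ι} M-ker Z-ι ι-onto = mk⇔
    (λ Mι-ker x Mx≈0 → *ᵥ-zero M (Mι-ker x λ a → Mx≈0 (ι a) (Z-ι a)))
    (λ meets x Mιx≈0 → M-ker x (meets x λ r z → case ι-onto r z of λ where (a , ≡.refl) → Mιx≈0 a))

  relabelRows-trivialKernel : ∀ {n m} {A : Matrix n m} (ρ : Permutation′ n) → TrivialKernel A →
    TrivialKernel (λ a b → A (ρ ⟨$⟩ʳ a) b)
  relabelRows-trivialKernel {A = A} ρ A-ker x ρAx≈0 =
    A-ker x λ r → trans (reflexive (≡.cong (λ s → (A *ᵥ x) s) (≡.sym (inverseʳ ρ)))) (ρAx≈0 (ρ ⟨$⟩ˡ r))

  relabelRows-spanMeetsTrivially⇔ : ∀ {n m i} (m≤n : m ℕ.≤ n) (A : Matrix n n) (ρ : Permutation′ n) {Z : Fin n → Set} →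
    (∀ a → i ℕ.≤ toℕ a → Z (ρ ⟨$⟩ʳ a)) → (∀ r → Z r → i ℕ.≤ toℕ (ρ ⟨$⟩ˡ r)) →
    ImageMeetsTrivially (leadingColumns m≤n A) Z ⇔ SpanMeetsTrivially (λ a b → A (ρ ⟨$⟩ʳ a) b) m i
  relabelRows-spanMeetsTrivially⇔ {m = m} {i} m≤n A ρ {Z} Z-above above-Z = mk⇔ to from
    where
    Aₘ = leadingColumns m≤n A
    at-ρ⁻¹ : ∀ v r → v (ρ ⟨$⟩ʳ (ρ ⟨$⟩ˡ r)) ≈ v r
    at-ρ⁻¹ v r = reflexive (≡.cong v (inverseʳ ρ))
    to : ImageMeetsTrivially Aₘ Z → SpanMeetsTrivially (λ a b → A (ρ ⟨$⟩ʳ a) b) m i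
    to meets x x≈0 ρAx≈0 a = trans (*ᵥ-vanishesFrom m≤n A x≈0 _) (meets _ Aₘx≈0 (ρ ⟨$⟩ʳ a))
      where
      Aₘx≈0 : ∀ r → Z r → (Aₘ *ᵥ (λ b → x (inject≤ b m≤n))) r ≈ 0#
      Aₘx≈0 r z = trans (sym (*ᵥ-vanishesFrom m≤n A x≈0 r))
                        (trans (sym (at-ρ⁻¹ (A *ᵥ x) r)) (ρAx≈0 (ρ ⟨$⟩ˡ r) (above-Z r z)))
    from : SpanMeetsTrivially (λ a b → A (ρ ⟨$⟩ʳ a) b) m i → ImageMeetsTrivially Aₘ Z
    from meets x Aₘx≈0 r = trans (sym (*ᵥ-extendByZero m≤n A x r))
      (trans (sym (at-ρ⁻¹ (A *ᵥ extendByZero m≤n x) r))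
             (meets (extendByZero m≤n x) (extendByZero-vanishes m≤n x)
                    (λ a i≤a → trans (*ᵥ-extendByZero m≤n A x _) (Aₘx≈0 _ (Z-above a i≤a))) (ρ ⟨$⟩ˡ r)))

open Permutations

module FlagConditions {c ℓ} (E : Field c ℓ) {n i} (i≤n : i ≤ n)
                      (F : LinAlg.Matrix E n n) (F-inv : LinAlg.Invertible E F)
                      {I : Subset n} (ρ : Permutation′ n)
                      (I≡ρ[<i] : ∀ r → r ∈ I ⇔ ∃ λ k → toℕ k < i × ρ ⟨$⟩ʳ k ≡ r)
                      {w : Fin n → Fin n} (g∈BẇB : LinAlg.InBruhatCell E (λ a b → F (ρ ⟨$⟩ʳ a) b) w) where

  open LinAlg E hiding (zero)
  open Matrices E
  open BruhatCell g∈BẇB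
  open EquationalReasoning

  m : ℕ
  m = n ∸ i

  m≤n : m ≤ n
  m≤n = m∸n≤m n i

  Fₘ : Matrix n m
  Fₘ = leadingColumns m≤n F

  F-ker : TrivialKernel F
  F-ker = invertible⇒trivialKernel F F-inv

  above⇒∉ : ∀ a → i ≤ toℕ a → ρ ⟨$⟩ʳ a ∉ I
  above⇒∉ a i≤a ρa∈I with Equivalence.to (I≡ρ[<i] _) ρa∈I
  ... | k , k<i , ρk≡ρa = ℕ.<⇒≱ (≡.subst (λ k → toℕ k < i) k≡a k<i) i≤a
    where
    k≡a : k ≡ a
    k≡a = ≡.trans (≡.sym (inverseˡ ρ)) (≡.trans (≡.cong (ρ ⟨$⟩ˡ_) ρk≡ρa) (inverseˡ ρ))

  ∉⇒above : ∀ r → r ∉ I → i ≤ toℕ (ρ ⟨$⟩ˡ r)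
  ∉⇒above r r∉I = ℕ.≮⇒≥ λ ρ⁻¹r<i →
    r∉I (Equivalence.from (I≡ρ[<i] r) (ρ ⟨$⟩ˡ r , ρ⁻¹r<i , inverseʳ ρ))

  w-inj : Injective _≡_ _≡_ w
  w-inj = w-injective (relabelRows-trivialKernel ρ F-ker)

  w∘w₀-injective : Injective _≡_ _≡_ (w ∘ opposite)
  w∘w₀-injective = opposite-injective ∘ w-inj

  Condition-ii : Set (c ⊔ ℓ)
  Condition-ii = ∀ (v : Fin n → Carrier) → (∃ λ (x : Fin m → Carrier) → ∀ r → v r ≈ (Fₘ *ᵥ x) r) →
                 (∀ r → r ∉ I → v r ≈ 0#) → ∀ r → v r ≈ 0#

  ii⇔preservesBlocks : Condition-ii ⇔ PreservesBlocks i (w ∘ opposite)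
  ii⇔preservesBlocks = begin
    Condition-ii                              ∼⟨ imageMeetsTrivially⇔ Fₘ (_∉ I) ⟩
    ImageMeetsTrivially Fₘ (_∉ I)             ∼⟨ relabelRows-spanMeetsTrivially⇔ m≤n F ρ above⇒∉ ∉⇒above ⟩
    SpanMeetsTrivially (λ a b → F (ρ ⟨$⟩ʳ a) b) m i  ∼⟨ spanMeetsTrivially⇔mapsPrefixAbove m i ⟩
    MapsPrefixAbove w m i                     ∼⟨ mapsPrefixAbove⇔preservesBlocks i≤n w-inj ⟩
    PreservesBlocks i (w ∘ opposite)          ∎

  ii⇔det≉0 : ∀ {ι : Fin m → Fin n} → (∀ r → r ∉ I ⇔ ∃ λ a → ι a ≡ r) →
             Condition-ii ⇔ det (λ a b → Fₘ (ι a) b) ≉ 0#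
  ii⇔det≉0 {ι} Iᶜ≡ι = begin
    Condition-ii                          ∼⟨ imageMeetsTrivially⇔ Fₘ (_∉ I) ⟩
    ImageMeetsTrivially Fₘ (_∉ I)         ∼⟨ ⇔-sym (selectRows-trivialKernel⇔ Fₘ-ker ι∉I (Equivalence.to ∘ Iᶜ≡ι)) ⟩
    TrivialKernel (λ a b → Fₘ (ι a) b)    ∼⟨ trivialKernel⇔det≉0 _ ⟩
    det (λ a b → Fₘ (ι a) b) ≉ 0#         ∎
    where
    Fₘ-ker : TrivialKernel Fₘ
    Fₘ-ker = leadingColumns-trivialKernel m≤n F-ker
    ι∉I : ∀ a → ι a ∉ I
    ι∉I a = Equivalence.from (Iᶜ≡ι (ι a)) (a , ≡.refl)

lemma2p5p3 : ∀ {c ℓ} (E : Field c ℓ) → let open LinAlg E in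
    (n : ℕ) → 2 ≤ n →
    -- eigenvalues φ_0,…,φ_{n-1} of φ^f on the basis e_0,…,e_{n-1}
    (p f : ℕ) → Prime p →
    (φ : Fin n → Carrier) →
    (∀ j → ¬ (φ j ≈ 0#)) →
    (∀ j k → j ≢ k → ¬ (φ j ≈ φ k) × ¬ (φ j ≈ fromℕ (p ^ f) * φ k)) →
    -- the full flag: Fil^(-h_j) D_σ = span of the first n-j columns of F
    (F : Matrix n n) → Invertible F →
    (i : ℕ) → 1 ≤ i → i < n →
    (I : Subset n) → ∣ I ∣ ≡ i →
    -- refinement R' = (φ_{ρ 0},…,φ_{ρ (n-1)}) compatible with I
    (ρ : Permutation′ n) →
    (∀ r → r ∈ I ⇔ (∃ λ k → toℕ k < i × ρ ⟨$⟩ʳ k ≡ r)) →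
    -- w = w_{R',σ}: g ∈ B ẇ B, with g the matrix of F in the basis e'_k = e_{ρ k}
    (w : Fin n → Fin n) → InBruhatCell (λ a b → F (ρ ⟨$⟩ʳ a) b) w →
    -- increasing enumeration ι of the complement I^c
    (ι : Fin (n ∸ i) → Fin n) →
    (∀ a b → toℕ a < toℕ b → toℕ (ι a) < toℕ (ι b)) →
    (∀ r → r ∉ I ⇔ (∃ λ a → ι a ≡ r)) →
    -- (i) "some reduced expression" ⇔ (ii)
    ((∃ λ (ls : List ℕ) → IsReducedExpression n ls (λ k → w (w₀ k)) × ¬ Occurs i ls)
       ⇔ (∀ (v : Fin n → Carrier) →
            (∃ λ (x : Fin (n ∸ i) → Carrier) →
               ∀ r → v r ≈ sumF (λ b → F r (inject≤ b (m∸n≤m n i)) * x b)) →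
            (∀ r → r ∉ I → v r ≈ 0#) →
            ∀ r → v r ≈ 0#))
    ×
    -- (i) "any reduced expression" ⇔ (ii)
    ((∀ (ls : List ℕ) → IsReducedExpression n ls (λ k → w (w₀ k)) → ¬ Occurs i ls)
       ⇔ (∀ (v : Fin n → Carrier) →
            (∃ λ (x : Fin (n ∸ i) → Carrier) →
               ∀ r → v r ≈ sumF (λ b → F r (inject≤ b (m∸n≤m n i)) * x b)) →
            (∀ r → r ∉ I → v r ≈ 0#) →
            ∀ r → v r ≈ 0#))
    ×
    -- (ii) ⇔ (iii): coefficient of e_{I^c} in f_1 ∧ … ∧ f_{n-i} is nonzero
    ((∀ (v : Fin n → Carrier) →
        (∃ λ (x : Fin (n ∸ i) → Carrier) →
           ∀ r → v r ≈ sumF (λ b → F r (inject≤ b (m∸n≤m n i)) * x b)) →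
        (∀ r → r ∉ I → v r ≈ 0#) →
        ∀ r → v r ≈ 0#)
       ⇔ (¬ (det (λ a b → F (ι a) (inject≤ b (m∸n≤m n i))) ≈ 0#)))
lemma2p5p3 E n _ _ _ _ _ _ _ F F-inv i _ i<n I _ ρ I≡ρ[<i] w g∈BẇB ι _ Iᶜ≡ι =
    ⇔-trans (someReduced⇔preservesBlocks w∘w₀-injective) (⇔-sym ii⇔preservesBlocks)
  , ⇔-trans (everyReduced⇔preservesBlocks w∘w₀-injective) (⇔-sym ii⇔preservesBlocks)
  , ii⇔det≉0 Iᶜ≡ι
  where
  open FlagConditions E (ℕ.<⇒≤ i<n) F F-inv ρ I≡ρ[<i] g∈BẇB
  open Blocks i
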